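{- Let $K$ be a finite field of characteristic $p$ and order $q$, with $p\equiv 1\pmod 4$, and let $s$ be a positive integer with $\gcd(s,q-1)=1$. Any Weil sum $W_u$ ($u\in K$) that lies in $\mathbb{Q}(\sqrt p)$ can be written uniquely in the form $(I+J\sqrt p)/2$ with $I,J\in\mathbb{Z}$. Furthermore $I\equiv J\pmod 2$ and $v_p(I)\ge 1$. If $s$ is nondegenerate over $K$, then $-q<-2(q-1)/(p-1)<I<2q$ and $|J|\le 2(q-1)/(p-1)<q$.
   Context: $\zeta=\exp(2\pi i/p)$, $\psi(x)=\zeta^{\mathrm{Tr}(x)}$ with $\mathrm{Tr}\colon K\to\mathbb{F}_p$ the absolute trace, and $W_u=\sum_{x\in K}\psi(x^s-ux)$. $v_p$ is the $p$-adic valuation. The exponent $s$ is nondegenerate over $K$ if $s\not\equiv p^k\pmod{q-1}$ for every integer $k$. -}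

module Defs where

open import Level using (0ℓ)
open import Data.Nat as ℕ using (ℕ; zero; suc; _∸_)
open import Data.Nat.Primality using (Prime)
open import Data.Fin using (Fin; toℕ)
open import Data.Bool using (Bool; true; false; if_then_else_)
open import Data.List using (List; upTo)
open import Data.Bool.ListAction using (any)
import Data.Integer.Divisibility as ℤd
open import Data.Product using (Σ; ∃; _×_; _,_)
open import Data.Integer as ℤ using (ℤ; +_)
open import Data.Rational as ℚ using (ℚ)
open import Relation.Nullary using (¬_; Dec; yes; no; does)
open import Relation.Binary.Definitions using (Decidable)
open import Relation.Binary.PropositionalEquality using (_≡_)
open import Algebra.Bundles using (CommutativeRing; Semiring)
import Algebra.Definitions.RawSemiring as RS

record FiniteField : Set₁ where
  field
    commRing : CommutativeRing 0ℓ 0ℓ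
  open CommutativeRing commRing public
  open RS (Semiring.rawSemiring (CommutativeRing.semiring commRing)) public using (_^_) renaming (_×_ to _·1×_)
  field
    _≟_    : Decidable _≈_
    1≉0    : ¬ (1# ≈ 0#)
    inv    : ∀ x → ¬ (x ≈ 0#) → ∃ λ y → (x * y) ≈ 1#
    size   : ℕ
    enum   : Fin size → Carrier
    enum-surj : ∀ x → ∃ λ i → enum i ≈ x
    enum-inj  : ∀ i j → enum i ≈ enum j → i ≡ j

count : (n : ℕ) → (Fin n → Bool) → ℕ
count zero    f = 0
count (suc n) f = (if f Fin.zero then 1 else 0) ℕ.+ count n (λ i → f (Fin.suc i))

module WeilSum (K : FiniteField) (p n : ℕ) where
  open FiniteField K

  Tr : Carrier → Carrier
  Tr x = go n
    where
      go : ℕ → Carrier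
      go zero    = 0#
      go (suc k) = go k + (x ^ (p ℕ.^ k))

  N : ℕ → Carrier → Fin p → ℕ
  N s u t = count size (λ i → does (Tr ((enum i ^ s) - (u * enum i)) ≟ (toℕ t ·1× 1#)))

-- The cyclotomic field ℚ(ζ), ζ = exp(2πi/p), p prime, presented as
--   ℚ^p / ℚ·(1,…,1):  a : Fin p → ℚ  represents  Σ_t a(t) ζ^t,
-- and since the only ℚ-linear relation among 1,ζ,…,ζ^(p-1) is
-- Σ_t ζ^t = 0, two vectors represent the same number iff their
-- difference is constant.

Cyc : ℕ → Set
Cyc p = Fin p → ℚ

_≈ᶜ_ : ∀ {p} → Cyc p → Cyc p → Set
a ≈ᶜ b = ∃ λ c → ∀ t → a t ℚ.- b t ≡ c

embed : ∀ {p} → ℚ → Cyc p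
embed r t with toℕ t
... | zero  = r
... | suc _ = ℚ.0ℚ

_·ᶜ_ : ∀ {p} → ℚ → Cyc p → Cyc p
(r ·ᶜ a) t = r ℚ.* a t

_+ᶜ_ : ∀ {p} → Cyc p → Cyc p → Cyc p
(a +ᶜ b) t = a t ℚ.+ b t

isSqMod : ℕ → ℕ → Bool
isSqMod p t = any (λ y → ((y ℕ.* y) ℕ.% suc (p ∸ 1)) ℕ.≡ᵇ t) (upTo p)

legendre : (p : ℕ) → Fin p → ℤ
legendre p t with toℕ t
... | zero  = + 0
... | suc k = if isSqMod p (suc k) then + 1 else ℤ.- (+ 1)

-- √p as the quadratic Gauss sum Σ_t (t/p) ζ^t
-- (Gauss: this equals +√p when p ≡ 1 mod 4)
sqrtp : (p : ℕ) → Cyc p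
sqrtp p t = legendre p t ℚ./ 1

-- the Weil sum W_u = Σ_x ψ(x^s - u x) = Σ_t N_t ζ^t as an element of ℚ(ζ)
W : (K : FiniteField) (p n s : ℕ) → FiniteField.Carrier K → Cyc p
W K p n s u t = (+ WeilSum.N K p n s u t) ℚ./ 1

Nondegenerate : (p q s : ℕ) → Set
Nondegenerate p q s = ∀ k → ¬ ((+ (q ∸ 1)) ℤd.∣ ((+ s) ℤ.- (+ (p ℕ.^ k))))

{-# OPTIONS --safe #-}
-- Write W = Σₜ Nₜ ζᵗ, where Nₜ counts the x ∈ K with Tr (x ^ s - u x) = t.  In the chosen
-- presentation of ℚ(ζ) the only relation among 1, ζ, …, ζ^(p-1) is Σₜ ζᵗ = 0, and √p is the
-- Gauss sum Σₜ (t/p) ζᵗ; so W ∈ ℚ(√p) forces Nₜ to depend only on the quadratic character of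
-- t ≠ 0, say N₊ on the (p-1)/2 squares and N₋ on the nonsquares.  Then 2W = I + J√p exactly for
-- I = 2N₀ - (N₊ + N₋) and J = N₊ - N₋, and q = N₀ + (p-1)/2 (N₊ + N₋) gives I = 2q - p (N₊ + N₋),
-- so p ∣ I, while I - J = 2 (N₀ - N₊).
-- The bounds are linear arithmetic once 1 ≤ N₀ < q.  N₀ ≥ 1 because of x = 0.  If N₀ = q, the
-- polynomial Tr (x ^ s - u x), with exponents reduced modulo q - 1 into [1, q - 1], would vanish
-- on all of K although its degree is below q; but when s is nondegenerate and coprime to q - 1
-- the monomial coming from x ^ s cancels against no other, so its coefficient is 1.
module Submission where

open import Defs
open import Data.Nat as ℕ using (ℕ; zero; suc; _∸_; _≤_; _<_; z≤n; s≤s; _!)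
import Data.Nat.Properties as ℕP
open import Data.Nat.Divisibility using (_∣_; divides; ∣⇒≤; m%n≡0⇒n∣m; m∣m*n; ∣1⇒≡1)
open import Data.Nat.Combinatorics using (_C_; k![n∸k]!∣n!; nCn≡1; nCk≡nC[n∸k])
open import Data.Nat.Combinatorics.Specification using (nCk≡n!/k![n-k]!)
open import Data.Nat.Properties using (_!*_!≢0)
open import Data.Nat.DivMod using (m≡m%n+[m/n]*n; m*[n/m]≡n; m%n<n; m<n⇒m%n≡m; [m+kn]%n≡m%n)
open import Data.Nat.Primality using (Prime; euclidsLemma; prime⇒nonTrivial; prime⇒nonZero)
open import Data.Nat.Coprimality as Coprime using (prime⇒coprime; coprime-Bézout; gcd≡1⇒coprime; coprime-divisor)
open import Data.Nat.GCD using (gcd; module Bézout)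
open import Algebra.Properties.CommutativeMonoid.Sum ℕP.+-0-commutativeMonoid
  using (sum-syntax; ∑-comm; ∑-distrib-+; sum-cong-≗)
open import Algebra.Bundles using (CommutativeRing)
open import Data.Integer as ℤ using (ℤ)
import Data.Integer.Properties as ℤP
import Data.Integer.Divisibility as ℤd
open import Data.Rational as ℚ using (ℚ)
import Data.Rational.Properties as ℚP
open import Data.Fin as Fin using (Fin; toℕ)
import Data.Fin.Properties as FinP
open import Data.Bool using (Bool; true; false; not; if_then_else_)
open import Data.Bool.Properties using (¬-not; not-injective; T-≡)
open import Data.List using (List; []; _∷_; length; upTo)
open import Data.List.Relation.Unary.All using (All; []; _∷_)
open import Data.List.Membership.Propositional using (find; lose)
open import Data.List.Membership.Propositional.Properties using (∈-upTo⁺; ∈-upTo⁻)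
open import Data.List.Relation.Unary.Any.Properties using (any⁺; any⁻)
open import Function.Base using (case_of_)
open import Function.Bundles using (Equivalence)
open import Data.Product using (∃; ∃₂; _×_; _,_; proj₁; proj₂)
open import Data.Sum using (_⊎_; inj₁; inj₂; [_,_]′)
open import Data.Empty using (⊥-elim)
open import Relation.Binary.Definitions using (tri<; tri≈; tri>)
open import Relation.Nullary using (¬_; Dec; yes; no; does)
open import Relation.Nullary.Decidable using (dec-true; dec-false)
open import Relation.Binary.PropositionalEquality as ≡
  using (_≡_; _≢_; module ≡-Reasoning)

prime⇒1<p : ∀ {p} → Prime p → 1 < p
prime⇒1<p {p} p-prime = ℕ.nonTrivial⇒n>1 p {{prime⇒nonTrivial p-prime}}

%≡%⇒∣∸ : ∀ m .{{_ : ℕ.NonZero m}} a b → a ℕ.% m ≡ b ℕ.% m → m ∣ a ∸ b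
%≡%⇒∣∸ m a b eq = divides (a / m ∸ b / m) (begin
  a ∸ b                                     ≡⟨ ≡.cong₂ _∸_ (m≡m%n+[m/n]*n a m) (m≡m%n+[m/n]*n b m) ⟩
  (a % m + a / m * m) ∸ (b % m + b / m * m) ≡⟨ ≡.cong (λ r → (a % m + a / m * m) ∸ (r + b / m * m)) (≡.sym eq) ⟩
  (a % m + a / m * m) ∸ (a % m + b / m * m) ≡⟨ ℕP.[m+n]∸[m+o]≡n∸o (a % m) _ _ ⟩
  a / m * m ∸ b / m * m                     ≡⟨ ≡.sym (ℕP.*-distribʳ-∸ m (a / m) (b / m)) ⟩
  (a / m ∸ b / m) * m                       ∎)
  where open ≡-Reasoning
        open import Data.Nat.Base using (_+_; _*_; _%_; _/_)

prime∣m!⇒≤ : ∀ {p} → Prime p → ∀ m → p ∣ m ! → p ≤ m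
prime∣m!⇒≤ p-prime zero    p∣1 = ⊥-elim (ℕP.<⇒≢ (prime⇒1<p p-prime) (≡.sym (∣1⇒≡1 p∣1)))
prime∣m!⇒≤ p-prime (suc m) p∣m! with euclidsLemma (suc m) (m !) p-prime p∣m!
... | inj₁ p∣1+m = ∣⇒≤ p∣1+m
... | inj₂ p∣m!′ = ℕP.m≤n⇒m≤1+n (prime∣m!⇒≤ p-prime m p∣m!′)

p∣pCk : ∀ {p} → Prime p → ∀ k → 0 < k → k < p → p ∣ p C k
p∣pCk {p} p-prime k 0<k k<p
  with euclidsLemma (k ! ℕ.* (p ∸ k) !) (p C k) p-prime p∣k![p∸k]!*pCk
  where
  instance
    k![p∸k]!≢0 : ℕ.NonZero (k ! ℕ.* (p ∸ k) !)
    k![p∸k]!≢0 = k !* (p ∸ k) !≢0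
  p∣p! : ∀ n → .{{ℕ.NonZero n}} → n ∣ n !
  p∣p! (suc n) = m∣m*n (n !)
  p∣k![p∸k]!*pCk : p ∣ (k ! ℕ.* (p ∸ k) !) ℕ.* (p C k)
  p∣k![p∸k]!*pCk = ≡.subst (p ∣_)
    (≡.sym (≡.trans (≡.cong ((k ! ℕ.* (p ∸ k) !) ℕ.*_) (nCk≡n!/k![n-k]! (ℕP.<⇒≤ k<p)))
                (m*[n/m]≡n (k![n∸k]!∣n! (ℕP.<⇒≤ k<p)))))
    (p∣p! p {{prime⇒nonZero p-prime}})
... | inj₂ p∣pCk = p∣pCk
... | inj₁ p∣k![p∸k]! with euclidsLemma (k !) ((p ∸ k) !) p-prime p∣k![p∸k]!
...   | inj₁ p∣k!     = ⊥-elim (ℕP.<⇒≱ k<p (prime∣m!⇒≤ p-prime k p∣k!))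
...   | inj₂ p∣[p∸k]! = ⊥-elim (ℕP.<⇒≱ (ℕP.∸-monoʳ-< 0<k (ℕP.<⇒≤ k<p)) (prime∣m!⇒≤ p-prime (p ∸ k) p∣[p∸k]!))

prime≡1[4]⇒p-1≡2h : ∀ {p₁} → Prime (suc p₁) → suc p₁ ℕ.% 4 ≡ 1 → ∃ λ h → 1 ≤ h × p₁ ≡ 2 ℕ.* h
prime≡1[4]⇒p-1≡2h {p₁} p-prime p%4≡1
  with suc p₁ ℕ./ 4 | ≡.trans (m≡m%n+[m/n]*n (suc p₁) 4) (≡.cong (ℕ._+ (suc p₁ ℕ./ 4) ℕ.* 4) p%4≡1)
... | zero  | p≡1    = ⊥-elim (ℕP.<-irrefl (≡.sym p≡1) (prime⇒1<p p-prime))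
... | suc d | p≡1+4d = 2 ℕ.* suc d , s≤s z≤n ,
  ≡.trans (ℕP.suc-injective p≡1+4d) (solve 1 (λ d → d :* con 4 := con 2 :* (con 2 :* d)) ≡.refl (suc d))
  where open import Data.Nat.Solver using (module +-*-Solver)
        open +-*-Solver using (solve; _:*_; _:=_; con)

i∣i*j : ∀ i j → i ℤd.∣ i ℤ.* j
i∣i*j i j = divides ℤ.∣ j ∣ (≡.trans (ℤP.abs-* i j) (ℕP.*-comm ℤ.∣ i ∣ ℤ.∣ j ∣))

does-true⇒ : ∀ {a} {A : Set a} (a? : Dec A) → does a? ≡ true → A
does-true⇒ (yes a) _ = a
does-true⇒ (no _)  ()

module Counting where
  open ≡ using (refl; sym; trans; cong; cong₂; subst)
  open import Data.Nat.Base using (_+_; _*_)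
  open import Algebra.Properties.CommutativeSemigroup ℕP.+-commutativeSemigroup
    using (x∙yz≈y∙xz)

  indicator : Bool → ℕ
  indicator b = if b then 1 else 0

  count≡∑indicator : ∀ n (f : Fin n → Bool) → count n f ≡ ∑[ i < n ] indicator (f i)
  count≡∑indicator zero    f = refl
  count≡∑indicator (suc n) f = cong (indicator (f Fin.zero) +_) (count≡∑indicator n (λ i → f (Fin.suc i)))

  count-none : ∀ n (f : Fin n → Bool) → (∀ i → f i ≡ false) → count n f ≡ 0
  count-none zero    f none = refl
  count-none (suc n) f none rewrite none Fin.zero = count-none n _ (λ i → none (Fin.suc i))

  count-all : ∀ n (f : Fin n → Bool) → (∀ i → f i ≡ true) → count n f ≡ n
  count-all zero    f all = refl
  count-all (suc n) f all rewrite all Fin.zero = cong suc (count-all n _ (λ i → all (Fin.suc i)))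

  count-≤ : ∀ n (f : Fin n → Bool) → count n f ≤ n
  count-≤ zero    f = z≤n
  count-≤ (suc n) f with f Fin.zero
  ... | true  = s≤s (count-≤ n _)
  ... | false = ℕP.m≤n⇒m≤1+n (count-≤ n _)

  count≡n⇒all : ∀ n (f : Fin n → Bool) → count n f ≡ n → ∀ i → f i ≡ true
  count≡n⇒all (suc n) f full i with f Fin.zero in f0
  count≡n⇒all (suc n) f full Fin.zero    | true  = f0
  count≡n⇒all (suc n) f full (Fin.suc i) | true  = count≡n⇒all n _ (ℕP.suc-injective full) i
  count≡n⇒all (suc n) f full i           | false =
    ⊥-elim (ℕP.1+n≰n (subst (_≤ n) full (count-≤ n _)))

  count-pos : ∀ n (f : Fin n → Bool) i → f i ≡ true → 1 ≤ count n f
  count-pos (suc n) f Fin.zero    fi rewrite fi = s≤s z≤n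
  count-pos (suc n) f (Fin.suc i) fi with f Fin.zero
  ... | true  = s≤s z≤n
  ... | false = count-pos n _ i fi

  count-pos⁻¹ : ∀ n (f : Fin n → Bool) → 1 ≤ count n f → ∃ λ i → f i ≡ true
  count-pos⁻¹ (suc n) f pos with f Fin.zero in f0
  ... | true  = Fin.zero , f0
  ... | false = let i , fi = count-pos⁻¹ n _ pos in Fin.suc i , fi

  count-unique : ∀ n (f : Fin n → Bool) i → f i ≡ true → (∀ j → f j ≡ true → j ≡ i) →
                 count n f ≡ 1
  count-unique (suc n) f Fin.zero fi unique rewrite fi =
    cong suc (count-none n _ (λ j → ¬-not (λ fj → FinP.0≢1+n (sym (unique (Fin.suc j) fj)))))
  count-unique (suc n) f (Fin.suc i) fi unique with f Fin.zero in f0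
  ... | true  = ⊥-elim (FinP.0≢1+n (unique Fin.zero f0))
  ... | false = count-unique n _ i fi (λ j fj → FinP.suc-injective (unique (Fin.suc j) fj))

  count+count-not : ∀ n (f : Fin n → Bool) → count n f + count n (λ i → not (f i)) ≡ n
  count+count-not zero    f = refl
  count+count-not (suc n) f with f Fin.zero
  ... | true  = cong suc (count+count-not n _)
  ... | false = trans (ℕP.+-suc _ _) (cong suc (count+count-not n _))

  ∑-if : ∀ n (f : Fin n → Bool) (a b : ℕ) →
         ∑[ i < n ] (if f i then a else b) ≡ count n f * a + count n (λ i → not (f i)) * b
  ∑-if zero    f a b = refl
  ∑-if (suc n) f a b with f Fin.zero
  ... | true  = trans (cong (a +_) (∑-if n _ a b)) (sym (ℕP.+-assoc a _ _))
  ... | false = trans (cong (b +_) (∑-if n _ a b)) (x∙yz≈y∙xz b (count n (λ i → f (Fin.suc i)) * a) _)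

  count-pair : ∀ n (f : Fin n → Bool) i j → i ≢ j → f i ≡ true → f j ≡ true →
               (∀ k → f k ≡ true → k ≡ i ⊎ k ≡ j) → count n f ≡ 2
  count-pair n f i j i≢j fi fj pair = begin
    count n f                  ≡⟨ count≡∑indicator n f ⟩
    ∑[ k < n ] indicator (f k) ≡⟨ sum-cong-≗ split ⟩
    ∑[ k < n ] (indicator (is i k) + indicator (is j k))
      ≡⟨ ∑-distrib-+ (λ k → indicator (is i k)) (λ k → indicator (is j k)) ⟩
    ∑[ k < n ] indicator (is i k) + ∑[ k < n ] indicator (is j k)
      ≡⟨ sym (cong₂ _+_ (count≡∑indicator n (is i)) (count≡∑indicator n (is j))) ⟩
    count n (is i) + count n (is j) ≡⟨ cong₂ _+_ (count-is i) (count-is j) ⟩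
    2                               ∎
    where
    open ≡-Reasoning
    is : Fin n → Fin n → Bool
    is i k = does (k FinP.≟ i)
    count-is : ∀ i → count n (is i) ≡ 1
    count-is i = count-unique n (is i) i (dec-true (i FinP.≟ i) refl) (λ k → does-true⇒ (k FinP.≟ i))
    split : ∀ k → indicator (f k) ≡ indicator (is i k) + indicator (is j k)
    split k with k FinP.≟ i | k FinP.≟ j
    ... | yes refl | yes refl = ⊥-elim (i≢j refl)
    ... | yes refl | no _     = cong indicator fi
    ... | no _     | yes refl = cong indicator fj
    ... | no k≢i   | no k≢j   with f k in fk
    ...   | false = refl
    ...   | true  = ⊥-elim ([ k≢i , k≢j ]′ (pair k fk))

  ∑-count-partition : ∀ k n (B : Fin k → Fin n → Bool) → (∀ i → count k (λ t → B t i) ≡ 1) →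
                      ∑[ t < k ] count n (B t) ≡ n
  ∑-count-partition k n B once = begin
    ∑[ t < k ] count n (B t)                ≡⟨ sum-cong-≗ (λ t → count≡∑indicator n (B t)) ⟩
    ∑[ t < k ] ∑[ i < n ] indicator (B t i) ≡⟨ ∑-comm (λ t i → indicator (B t i)) ⟩
    ∑[ i < n ] ∑[ t < k ] indicator (B t i) ≡⟨ sum-cong-≗ once′ ⟩
    ∑[ i < n ] indicator true               ≡⟨ sym (count≡∑indicator n (λ _ → true)) ⟩
    count n (λ _ → true)                    ≡⟨ count-all n _ (λ _ → refl) ⟩
    n                                       ∎
    where
    open ≡-Reasoning
    once′ : ∀ i → ∑[ t < k ] indicator (B t i) ≡ 1
    once′ i = trans (sym (count≡∑indicator k (λ t → B t i))) (once i)

module QuadraticResidues {p₁ h : ℕ} (p-prime : Prime (suc p₁)) (p₁≡2h : p₁ ≡ 2 ℕ.* h) where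
  open ≡ using (refl; sym; trans; cong; cong₂; subst)
  open import Data.Nat.Base using (_+_; _*_; _%_; _≡ᵇ_)
  open Counting

  p : ℕ
  p = suc p₁

  instance
    p-nonZero : ℕ.NonZero p
    p-nonZero = _

  square : ℕ → ℕ
  square y = (y * y) % p

  isSqMod⇒ : ∀ {t} → isSqMod p t ≡ true → ∃ λ y → y < p × square y ≡ t
  isSqMod⇒ {t} sq with find (any⁻ (λ y → square y ≡ᵇ t) (upTo p) (Equivalence.from T-≡ sq))
  ... | y , y∈ , sq≡ = y , ∈-upTo⁻ y∈ , ℕP.≡ᵇ⇒≡ _ _ sq≡

  ⇒isSqMod : ∀ {t} y → y < p → square y ≡ t → isSqMod p t ≡ true
  ⇒isSqMod {t} y y<p sq≡ =
    Equivalence.to T-≡ (any⁺ (λ y → square y ≡ᵇ t) (lose (∈-upTo⁺ y<p) (ℕP.≡⇒≡ᵇ _ _ sq≡)))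

  private
    below-p-∣⇒≡0 : ∀ m → m < p → p ∣ m → m ≡ 0
    below-p-∣⇒≡0 zero    _   _   = refl
    below-p-∣⇒≡0 (suc m) m<p p∣m = ⊥-elim (ℕP.<⇒≱ m<p (∣⇒≤ p∣m))

    y*y∸z*z : ∀ y z → z ≤ y → y * y ∸ z * z ≡ (y ∸ z) * (y + z)
    y*y∸z*z y z z≤y = begin
      y * y ∸ z * z                     ≡⟨ cong (λ w → w * w ∸ z * z) (sym y≡z+d) ⟩
      (z + d) * (z + d) ∸ z * z
        ≡⟨ cong (_∸ z * z) (solve 2 (λ z d → (z :+ d) :* (z :+ d) := z :* z :+ d :* ((z :+ d) :+ z)) refl z d) ⟩
      z * z + d * ((z + d) + z) ∸ z * z ≡⟨ ℕP.m+n∸m≡n (z * z) _ ⟩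
      d * ((z + d) + z)                 ≡⟨ cong (λ w → d * (w + z)) y≡z+d ⟩
      d * (y + z)                       ∎
      where
      open ≡-Reasoning
      open import Data.Nat.Solver using (module +-*-Solver)
      open +-*-Solver
      d : ℕ
      d = y ∸ z
      y≡z+d : z + d ≡ y
      y≡z+d = ℕP.m+[n∸m]≡n z≤y

  square≡0⇒≡0 : ∀ y → y < p → square y ≡ 0 → y ≡ 0
  square≡0⇒≡0 y y<p sq≡0 with euclidsLemma y y p-prime (m%n≡0⇒n∣m (y * y) p sq≡0)
  ... | inj₁ p∣y = below-p-∣⇒≡0 y y<p p∣y
  ... | inj₂ p∣y = below-p-∣⇒≡0 y y<p p∣y

  private
    square-roots≤ : ∀ y z → y < p → z ≤ y → square y ≡ square z → z ≡ y ⊎ z + y ≡ p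
    square-roots≤ y z y<p z≤y sq≡
      with euclidsLemma (y ∸ z) (y + z) p-prime
             (subst (p ∣_) (y*y∸z*z y z z≤y) (%≡%⇒∣∸ p (y * y) (z * z) sq≡))
    ... | inj₁ p∣y∸z = inj₁ (ℕP.≤-antisym z≤y (ℕP.m∸n≡0⇒m≤n
                          (below-p-∣⇒≡0 (y ∸ z) (ℕP.≤-<-trans (ℕP.m∸n≤m y z) y<p) p∣y∸z)))
    ... | inj₂ (divides zero          y+z≡0) =
      inj₁ (trans (ℕP.m+n≡0⇒n≡0 y y+z≡0) (sym (ℕP.m+n≡0⇒m≡0 y y+z≡0)))
    ... | inj₂ (divides (suc zero)    y+z≡p) = inj₂ (trans (ℕP.+-comm z y) (trans y+z≡p (ℕP.+-identityʳ p)))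
    ... | inj₂ (divides (suc (suc k)) y+z≡kp) = ⊥-elim (ℕP.<⇒≱ y+z<p+p (begin
      p + p           ≤⟨ ℕP.+-monoʳ-≤ p (ℕP.m≤m+n p _) ⟩
      p + (p + k * p) ≡⟨ sym y+z≡kp ⟩
      y + z           ∎))
      where
      open ℕP.≤-Reasoning
      y+z<p+p : y + z < p + p
      y+z<p+p = ℕP.+-mono-<-≤ y<p (ℕP.≤-trans z≤y (ℕP.<⇒≤ y<p))

  square-roots : ∀ y z → y < p → z < p → square y ≡ square z → z ≡ y ⊎ z + y ≡ p
  square-roots y z y<p z<p sq≡ with ℕP.≤-total z y
  ... | inj₁ z≤y = square-roots≤ y z y<p z≤y sq≡
  ... | inj₂ y≤z with square-roots≤ z y z<p y≤z (sym sq≡)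
  ...   | inj₁ y≡z   = inj₁ (sym y≡z)
  ...   | inj₂ y+z≡p = inj₂ (trans (ℕP.+-comm z y) y+z≡p)

  square-p∸ : ∀ y → y ≤ p → square (p ∸ y) ≡ square y
  square-p∸ y y≤p = begin
    (w * w) % p         ≡⟨ sym ([m+kn]%n≡m%n (w * w) y p) ⟩
    (w * w + y * p) % p ≡⟨ cong (λ z → (w * w + y * z) % p) (sym w+y≡p) ⟩
    (w * w + y * (w + y)) % p
      ≡⟨ cong (_% p) (solve 2 (λ w y → w :* w :+ y :* (w :+ y) := y :* y :+ w :* (w :+ y)) refl w y) ⟩
    (y * y + w * (w + y)) % p ≡⟨ cong (λ z → (y * y + w * z) % p) w+y≡p ⟩
    (y * y + w * p) % p       ≡⟨ [m+kn]%n≡m%n (y * y) w p ⟩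
    (y * y) % p               ∎
    where
    open ≡-Reasoning
    open import Data.Nat.Solver using (module +-*-Solver)
    open +-*-Solver
    w : ℕ
    w = p ∸ y
    w+y≡p : w + y ≡ p
    w+y≡p = ℕP.m∸n+n≡m y≤p

  isResidue : Fin p₁ → Bool
  isResidue r = isSqMod p (suc (toℕ r))

  rootCount : Fin p → ℕ
  rootCount t = count p (λ y → does (square (toℕ y) ℕ.≟ toℕ t))

  ∑-rootCount : ∑[ t < p ] rootCount t ≡ p
  ∑-rootCount = ∑-count-partition p p (λ t y → does (square (toℕ y) ℕ.≟ toℕ t)) λ y →
    count-unique p _ (Fin.fromℕ< (m%n<n (toℕ y * toℕ y) p))
      (dec-true (square (toℕ y) ℕ.≟ _) (sym (FinP.toℕ-fromℕ< _)))
      (λ t sq≡t → FinP.toℕ-injective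
        (trans (sym (does-true⇒ (square (toℕ y) ℕ.≟ toℕ t) sq≡t)) (sym (FinP.toℕ-fromℕ< _))))

  rootCount-zero : rootCount Fin.zero ≡ 1
  rootCount-zero = count-unique p _ Fin.zero refl λ y sq≡0 →
    FinP.toℕ-injective (square≡0⇒≡0 (toℕ y) (FinP.toℕ<n y) (does-true⇒ (square (toℕ y) ℕ.≟ 0) sq≡0))

  rootCount-square : ∀ r y → y < p → square y ≡ suc (toℕ r) → rootCount (Fin.suc r) ≡ 2
  rootCount-square r y y<p sq≡t =
    count-pair p _ (Fin.fromℕ< y<p) (Fin.fromℕ< w<p) y≢w
      (dec-true (square (toℕ (Fin.fromℕ< y<p)) ℕ.≟ t) (trans (cong square (FinP.toℕ-fromℕ< y<p)) sq≡t))
      (dec-true (square (toℕ (Fin.fromℕ< w<p)) ℕ.≟ t)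
        (trans (cong square (FinP.toℕ-fromℕ< w<p)) (trans (square-p∸ y (ℕP.<⇒≤ y<p)) sq≡t)))
      only
    where
    t w : ℕ
    t = suc (toℕ r)
    w = p ∸ y
    y≢0 : y ≢ 0
    y≢0 refl = case sq≡t of λ ()
    w<p : w < p
    w<p = ℕP.∸-monoʳ-< (ℕP.n≢0⇒n>0 y≢0) (ℕP.<⇒≤ y<p)
    y≢w : Fin.fromℕ< y<p ≢ Fin.fromℕ< w<p
    y≢w eq = ℕP.even≢odd y h (begin
      2 * y       ≡⟨ cong (y +_) (ℕP.+-identityʳ y) ⟩
      y + y       ≡⟨ cong (_+ y) y≡w ⟩
      w + y       ≡⟨ ℕP.m∸n+n≡m (ℕP.<⇒≤ y<p) ⟩
      suc p₁      ≡⟨ cong suc p₁≡2h ⟩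
      suc (2 * h) ∎)
      where
      open ≡-Reasoning
      y≡w : y ≡ w
      y≡w = trans (sym (FinP.toℕ-fromℕ< y<p)) (trans (cong toℕ eq) (FinP.toℕ-fromℕ< w<p))
    only : ∀ k → does (square (toℕ k) ℕ.≟ t) ≡ true → k ≡ Fin.fromℕ< y<p ⊎ k ≡ Fin.fromℕ< w<p
    only k sq≡t′
      with square-roots y (toℕ k) y<p (FinP.toℕ<n k) (trans sq≡t (sym (does-true⇒ (square (toℕ k) ℕ.≟ t) sq≡t′)))
    ... | inj₁ k≡y   = inj₁ (FinP.toℕ-injective (trans k≡y (sym (FinP.toℕ-fromℕ< y<p))))
    ... | inj₂ k+y≡p = inj₂ (FinP.toℕ-injective
      (trans (trans (sym (ℕP.m+n∸n≡m (toℕ k) y)) (cong (_∸ y) k+y≡p)) (sym (FinP.toℕ-fromℕ< w<p))))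

  rootCount-suc : ∀ r → rootCount (Fin.suc r) ≡ (if isResidue r then 2 else 0)
  rootCount-suc r with isResidue r in residue
  ... | true  = let y , y<p , sq≡t = isSqMod⇒ residue in rootCount-square r y y<p sq≡t
  ... | false = count-none p _ λ y → dec-false (square (toℕ y) ℕ.≟ suc (toℕ r)) λ sq≡t →
    case trans (sym residue) (⇒isSqMod (toℕ y) (FinP.toℕ<n y) sq≡t) of λ ()

  count-residues : count p₁ isResidue ≡ h
  count-residues = ℕP.*-cancelʳ-≡ _ h 2 (begin
    count p₁ isResidue * 2
      ≡⟨ sym (ℕP.+-identityʳ _) ⟩
    count p₁ isResidue * 2 + 0
      ≡⟨ cong (count p₁ isResidue * 2 +_) (sym (ℕP.*-zeroʳ (count p₁ (λ r → not (isResidue r))))) ⟩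
    count p₁ isResidue * 2 + count p₁ (λ r → not (isResidue r)) * 0
      ≡⟨ sym (∑-if p₁ isResidue 2 0) ⟩
    ∑[ r < p₁ ] (if isResidue r then 2 else 0)
      ≡⟨ sum-cong-≗ (λ r → sym (rootCount-suc r)) ⟩
    ∑[ r < p₁ ] rootCount (Fin.suc r)
      ≡⟨ ℕP.suc-injective (trans (cong (_+ ∑[ r < p₁ ] rootCount (Fin.suc r)) (sym rootCount-zero)) ∑-rootCount) ⟩
    p₁
      ≡⟨ trans p₁≡2h (ℕP.*-comm 2 h) ⟩
    h * 2
      ∎)
    where open ≡-Reasoning

  count-nonresidues : count p₁ (λ r → not (isResidue r)) ≡ h
  count-nonresidues = ℕP.+-cancelˡ-≡ h _ h (begin
    h + count p₁ (λ r → not (isResidue r))                  ≡⟨ cong (_+ count p₁ (λ r → not (isResidue r))) (sym count-residues) ⟩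
    count p₁ isResidue + count p₁ (λ r → not (isResidue r)) ≡⟨ count+count-not p₁ isResidue ⟩
    p₁                                                      ≡⟨ p₁≡2h ⟩
    2 * h                                                   ≡⟨ cong (h +_) (ℕP.+-identityʳ h) ⟩
    h + h                                                   ∎)
    where open ≡-Reasoning

  module _ (1≤h : 1 ≤ h) where

    residue : ∃ λ r → isResidue r ≡ true
    residue = count-pos⁻¹ p₁ isResidue (subst (1 ≤_) (sym count-residues) 1≤h)

    nonresidue : ∃ λ r → isResidue r ≡ false
    nonresidue with count-pos⁻¹ p₁ _ (subst (1 ≤_) (sym count-nonresidues) 1≤h)
    ... | r , not-residue = r , not-injective not-residue

module Powers {c ℓ} (R : CommutativeRing c ℓ) where
  open CommutativeRing R
  open import Relation.Binary.Reasoning.Setoid setoid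
  open import Algebra.Properties.Group +-group using (inverseʳ-unique)
  open import Algebra.Properties.Semiring.Mult semiring
    using (×-homo-1; ×-congʳ; ×-assocˡ; ×-assoc-*) renaming (_×_ to _·1×_)
  open import Algebra.Properties.Semiring.Exp semiring using (_^_; ^-congˡ; ^-assocʳ)
  import Algebra.Properties.CommutativeSemiring.Binomial commutativeSemiring as Binomial
  open import Algebra.Properties.Monoid.Sum +-monoid using (sum; sum-init-last)

  private
    binomial-last : ∀ n k → k ≡ n → ∀ x y → (n C k) ·1× (x ^ k * y ^ (n ∸ k)) ≈ x ^ n
    binomial-last n .n ≡.refl x y = begin
      (n C n) ·1× (x ^ n * y ^ (n ∸ n)) ≡⟨ ≡.cong₂ (λ a b → a ·1× (x ^ n * y ^ b)) (nCn≡1 n) (ℕP.n∸n≡0 n) ⟩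
      1 ·1× (x ^ n * 1#)                ≈⟨ ×-homo-1 _ ⟩
      x ^ n * 1#                        ≈⟨ *-identityʳ _ ⟩
      x ^ n                             ∎

    binomial-first : ∀ n x y → (n C 0) ·1× (x ^ 0 * y ^ (n ∸ 0)) ≈ y ^ n
    binomial-first n x y = begin
      (n C 0) ·1× (1# * y ^ n) ≡⟨ ≡.cong (_·1× (1# * y ^ n)) (≡.trans (nCk≡nC[n∸k] {0} {n} z≤n) (nCn≡1 n)) ⟩
      1 ·1× (1# * y ^ n)       ≈⟨ ×-homo-1 _ ⟩
      1# * y ^ n               ≈⟨ *-identityˡ _ ⟩
      y ^ n                    ∎

    sum≈0 : ∀ {n} (v : Fin n → Carrier) → (∀ i → v i ≈ 0#) → sum v ≈ 0#
    sum≈0 {zero}  v v≈0 = refl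
    sum≈0 {suc n} v v≈0 = trans (+-cong (v≈0 Fin.zero) (sum≈0 (λ i → v (Fin.suc i)) (λ i → v≈0 (Fin.suc i)))) (+-identityʳ 0#)

  0^n≈0 : ∀ n .{{_ : ℕ.NonZero n}} → 0# ^ n ≈ 0#
  0^n≈0 (suc n) = zeroˡ _

  1^n≈1 : ∀ n → 1# ^ n ≈ 1#
  1^n≈1 zero    = refl
  1^n≈1 (suc n) = trans (*-identityˡ _) (1^n≈1 n)

  freshman's-dream : ∀ n .{{_ : ℕ.NonZero n}} → (∀ k → 0 < k → k < n → ∀ w → (n C k) ·1× w ≈ 0#) →
                     ∀ x y → (x + y) ^ n ≈ x ^ n + y ^ n
  freshman's-dream n@(suc m) inner x y = begin
    (x + y) ^ n ≈⟨ Binomial.theorem n x y ⟩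
    sum t       ≈⟨ +-congˡ (sum-init-last (λ i → t (Fin.suc i))) ⟩
    t Fin.zero + (sum (λ i → t (Fin.suc (Fin.inject₁ i))) + t (Fin.suc (Fin.fromℕ m)))
      ≈⟨ +-cong (binomial-first n x y) (+-cong (sum≈0 _ middle≈0) (binomial-last n _ (≡.cong suc (FinP.toℕ-fromℕ m)) x y)) ⟩
    y ^ n + (0# + x ^ n) ≈⟨ +-congˡ (+-identityˡ _) ⟩
    y ^ n + x ^ n        ≈⟨ +-comm _ _ ⟩
    x ^ n + y ^ n        ∎
    where
    t : Fin (suc n) → Carrier
    t = Binomial.binomialTerm x y n
    middle≈0 : ∀ i → t (Fin.suc (Fin.inject₁ i)) ≈ 0#
    middle≈0 i = inner (suc (toℕ (Fin.inject₁ i))) (s≤s z≤n)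
      (s≤s (≡.subst (_< m) (≡.sym (FinP.toℕ-inject₁ i)) (FinP.toℕ<n i))) _

  module Frobenius {p} (p-prime : Prime p) (char : p ·1× 1# ≈ 0#) where

    p·1×x≈0 : ∀ x → p ·1× x ≈ 0#
    p·1×x≈0 x = begin
      p ·1× x        ≈⟨ ×-congʳ p (sym (*-identityˡ x)) ⟩
      p ·1× (1# * x) ≈⟨ sym (×-assoc-* p 1# x) ⟩
      (p ·1× 1#) * x ≈⟨ *-congʳ char ⟩
      0# * x         ≈⟨ zeroˡ x ⟩
      0#             ∎

    p∣n⇒n·1×x≈0 : ∀ {n} x → p ∣ n → n ·1× x ≈ 0#
    p∣n⇒n·1×x≈0 x (divides m ≡.refl) = begin
      (m ℕ.* p) ·1× x ≡⟨ ≡.cong (_·1× x) (ℕP.*-comm m p) ⟩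
      (p ℕ.* m) ·1× x ≈⟨ sym (×-assocˡ x p m) ⟩
      p ·1× (m ·1× x) ≈⟨ p·1×x≈0 (m ·1× x) ⟩
      0#              ∎

    private
      instance
        p-nonZero : ℕ.NonZero p
        p-nonZero = prime⇒nonZero p-prime

    frobenius-+ : ∀ x y → (x + y) ^ p ≈ x ^ p + y ^ p
    frobenius-+ = freshman's-dream p λ k 0<k k<p w → p∣n⇒n·1×x≈0 w (p∣pCk p-prime k 0<k k<p)

    0^p≈0 : 0# ^ p ≈ 0#
    0^p≈0 = 0^n≈0 p

    frobenius-neg : ∀ x → (- x) ^ p ≈ - (x ^ p)
    frobenius-neg x = inverseʳ-unique (x ^ p) ((- x) ^ p) (begin
      x ^ p + (- x) ^ p ≈⟨ sym (frobenius-+ x (- x)) ⟩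
      (x - x) ^ p       ≈⟨ ^-congˡ p (-‿inverseʳ x) ⟩
      0# ^ p            ≈⟨ 0^p≈0 ⟩
      0#                ∎)

    ·1×-^p : ∀ n → (n ·1× 1#) ^ p ≈ n ·1× 1#
    ·1×-^p zero    = 0^p≈0
    ·1×-^p (suc n) = begin
      (1# + n ·1× 1#) ^ p     ≈⟨ frobenius-+ 1# (n ·1× 1#) ⟩
      1# ^ p + (n ·1× 1#) ^ p ≈⟨ +-cong (1^n≈1 p) (·1×-^p n) ⟩
      1# + n ·1× 1#           ∎

    ^p^-suc : ∀ x k → x ^ (p ℕ.^ suc k) ≈ (x ^ p) ^ (p ℕ.^ k)
    ^p^-suc x k = sym (^-assocʳ x p (p ℕ.^ k))

    frobenius^-+ : ∀ k x y → (x + y) ^ (p ℕ.^ k) ≈ x ^ (p ℕ.^ k) + y ^ (p ℕ.^ k)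
    frobenius^-+ zero    x y = trans (*-identityʳ _) (sym (+-cong (*-identityʳ x) (*-identityʳ y)))
    frobenius^-+ (suc k) x y = begin
      (x + y) ^ (p ℕ.^ suc k)                   ≈⟨ ^p^-suc (x + y) k ⟩
      ((x + y) ^ p) ^ (p ℕ.^ k)                 ≈⟨ ^-congˡ (p ℕ.^ k) (frobenius-+ x y) ⟩
      (x ^ p + y ^ p) ^ (p ℕ.^ k)               ≈⟨ frobenius^-+ k (x ^ p) (y ^ p) ⟩
      (x ^ p) ^ (p ℕ.^ k) + (y ^ p) ^ (p ℕ.^ k) ≈⟨ sym (+-cong (^p^-suc x k) (^p^-suc y k)) ⟩
      x ^ (p ℕ.^ suc k) + y ^ (p ℕ.^ suc k)     ∎

    frobenius^-neg : ∀ k x → (- x) ^ (p ℕ.^ k) ≈ - (x ^ (p ℕ.^ k))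
    frobenius^-neg zero    x = trans (*-identityʳ _) (-‿cong (sym (*-identityʳ x)))
    frobenius^-neg (suc k) x = begin
      (- x) ^ (p ℕ.^ suc k)   ≈⟨ ^p^-suc (- x) k ⟩
      ((- x) ^ p) ^ (p ℕ.^ k) ≈⟨ ^-congˡ (p ℕ.^ k) (frobenius-neg x) ⟩
      (- (x ^ p)) ^ (p ℕ.^ k) ≈⟨ frobenius^-neg k (x ^ p) ⟩
      - ((x ^ p) ^ (p ℕ.^ k)) ≈⟨ -‿cong (sym (^p^-suc x k)) ⟩
      - (x ^ (p ℕ.^ suc k))   ∎

module Polynomials (K : FiniteField) where
  open FiniteField K
  open import Relation.Binary.Reasoning.Setoid setoid
  open import Algebra.Properties.Ring ring using (-‿distribˡ-*)
  open import Algebra.Properties.Group +-group using (//-rightDividesˡ; x∙y⁻¹≈ε⇒x≈y)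
  open import Algebra.Solver.Ring.NaturalCoefficients.Default commutativeSemiring
    using (solve; _:+_; _:*_; _:=_)

  *-≉0 : ∀ {x y} → ¬ x ≈ 0# → ¬ y ≈ 0# → ¬ x * y ≈ 0#
  *-≉0 {x} {y} x≉0 y≉0 xy≈0 with inv y y≉0
  ... | y⁻¹ , yy⁻¹≈1 = x≉0 (begin
    x             ≈⟨ sym (*-identityʳ x) ⟩
    x * 1#        ≈⟨ *-congˡ (sym yy⁻¹≈1) ⟩
    x * (y * y⁻¹) ≈⟨ sym (*-assoc x y y⁻¹) ⟩
    (x * y) * y⁻¹ ≈⟨ *-congʳ xy≈0 ⟩
    0# * y⁻¹      ≈⟨ zeroˡ y⁻¹ ⟩
    0#            ∎)

  *-cancel-≉0 : ∀ {c x} → ¬ c ≈ 0# → c * x ≈ 0# → x ≈ 0#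
  *-cancel-≉0 {c} {x} c≉0 cx≈0 with x ≟ 0#
  ... | yes x≈0 = x≈0
  ... | no  x≉0 = ⊥-elim (*-≉0 c≉0 x≉0 cx≈0)

  Poly : Set
  Poly = List Carrier

  eval : Poly → Carrier → Carrier
  eval []      x = 0#
  eval (c ∷ f) x = c + x * eval f x

  coeff : Poly → ℕ → Carrier
  coeff []      j       = 0#
  coeff (c ∷ f) zero    = c
  coeff (c ∷ f) (suc j) = coeff f j

  monomial : Carrier → ℕ → Poly
  monomial c zero    = c ∷ []
  monomial c (suc e) = 0# ∷ monomial c e

  infixl 6 _⊕_
  _⊕_ : Poly → Poly → Poly
  []      ⊕ g       = g
  (a ∷ f) ⊕ []      = a ∷ f
  (a ∷ f) ⊕ (b ∷ g) = (a + b) ∷ (f ⊕ g)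

  eval-monomial : ∀ c e x → eval (monomial c e) x ≈ c * x ^ e
  eval-monomial c zero    x = trans (+-congˡ (zeroʳ x)) (trans (+-identityʳ c) (sym (*-identityʳ c)))
  eval-monomial c (suc e) x = begin
    0# + x * eval (monomial c e) x ≈⟨ +-identityˡ _ ⟩
    x * eval (monomial c e) x      ≈⟨ *-congˡ (eval-monomial c e x) ⟩
    x * (c * x ^ e)                ≈⟨ solve 3 (λ x c y → x :* (c :* y) := c :* (x :* y)) refl x c (x ^ e) ⟩
    c * (x * x ^ e)                ∎

  eval-⊕ : ∀ f g x → eval (f ⊕ g) x ≈ eval f x + eval g x
  eval-⊕ []      g       x = sym (+-identityˡ _)
  eval-⊕ (a ∷ f) []      x = sym (+-identityʳ _)
  eval-⊕ (a ∷ f) (b ∷ g) x = begin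
    (a + b) + x * eval (f ⊕ g) x            ≈⟨ +-congˡ (*-congˡ (eval-⊕ f g x)) ⟩
    (a + b) + x * (eval f x + eval g x)
      ≈⟨ solve 5 (λ a b x u v → (a :+ b) :+ x :* (u :+ v) := (a :+ x :* u) :+ (b :+ x :* v)) refl a b x (eval f x) (eval g x) ⟩
    (a + x * eval f x) + (b + x * eval g x) ∎

  coeff-⊕ : ∀ f g j → coeff (f ⊕ g) j ≈ coeff f j + coeff g j
  coeff-⊕ []      g       j       = sym (+-identityˡ _)
  coeff-⊕ (a ∷ f) []      zero    = sym (+-identityʳ _)
  coeff-⊕ (a ∷ f) []      (suc j) = sym (+-identityʳ _)
  coeff-⊕ (a ∷ f) (b ∷ g) zero    = refl
  coeff-⊕ (a ∷ f) (b ∷ g) (suc j) = coeff-⊕ f g j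

  coeff-monomial-≡ : ∀ c e → coeff (monomial c e) e ≈ c
  coeff-monomial-≡ c zero    = refl
  coeff-monomial-≡ c (suc e) = coeff-monomial-≡ c e

  coeff-monomial-≢ : ∀ c e j → e ≢ j → coeff (monomial c e) j ≈ 0#
  coeff-monomial-≢ c zero    zero    e≢j = ⊥-elim (e≢j ≡.refl)
  coeff-monomial-≢ c zero    (suc j) e≢j = refl
  coeff-monomial-≢ c (suc e) zero    e≢j = refl
  coeff-monomial-≢ c (suc e) (suc j) e≢j = coeff-monomial-≢ c e j (λ e≡j → e≢j (≡.cong suc e≡j))

  length-monomial : ∀ c e {m} → e < m → length (monomial c e) ≤ m
  length-monomial c zero    (s≤s _)   = s≤s z≤n
  length-monomial c (suc e) (s≤s e<m) = s≤s (length-monomial c e e<m)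

  length-⊕ : ∀ f g {m} → length f ≤ m → length g ≤ m → length (f ⊕ g) ≤ m
  length-⊕ []      g       f≤m       g≤m       = g≤m
  length-⊕ (a ∷ f) []      f≤m       g≤m       = f≤m
  length-⊕ (a ∷ f) (b ∷ g) (s≤s f≤m) (s≤s g≤m) = s≤s (length-⊕ f g f≤m g≤m)

  All≈0⇒coeff≈0 : ∀ f j → All (_≈ 0#) f → coeff f j ≈ 0#
  All≈0⇒coeff≈0 []      j       []         = refl
  All≈0⇒coeff≈0 (c ∷ f) zero    (c≈0 ∷ _)  = c≈0
  All≈0⇒coeff≈0 (c ∷ f) (suc j) (_ ∷ f≈0)  = All≈0⇒coeff≈0 f j f≈0

  quotient : Poly → Carrier → Poly
  quotient []          a = []
  quotient (c ∷ [])    a = []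
  quotient (c ∷ d ∷ f) a = eval (d ∷ f) a ∷ quotient (d ∷ f) a

  length-quotient : ∀ f a → length (quotient f a) ≡ ℕ.pred (length f)
  length-quotient []          a = ≡.refl
  length-quotient (c ∷ [])    a = ≡.refl
  length-quotient (c ∷ d ∷ f) a = ≡.cong suc (length-quotient (d ∷ f) a)

  factor-theorem : ∀ f a x → eval f x ≈ (x - a) * eval (quotient f a) x + eval f a
  factor-theorem []          a x = sym (trans (+-congʳ (zeroʳ _)) (+-identityʳ 0#))
  factor-theorem (c ∷ [])    a x = begin
    c + x * 0#                  ≈⟨ +-congˡ (zeroʳ x) ⟩
    c + 0#                      ≈⟨ sym (+-congˡ (zeroʳ a)) ⟩
    c + a * 0#                  ≈⟨ sym (+-identityˡ _) ⟩
    0# + (c + a * 0#)           ≈⟨ sym (+-congʳ (zeroʳ (x - a))) ⟩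
    (x - a) * 0# + (c + a * 0#) ∎
  -- Writing x as δ + a turns this step into a semiring identity.
  factor-theorem (c ∷ d ∷ f) a x = begin
    c + x * eval (d ∷ f) x                  ≈⟨ +-congˡ (*-cong (sym x≈d+a) (factor-theorem (d ∷ f) a x)) ⟩
    c + (δ + a) * (δ * G + F)
      ≈⟨ solve 5 (λ c δ a F G → c :+ (δ :+ a) :* (δ :* G :+ F) := δ :* (F :+ (δ :+ a) :* G) :+ (c :+ a :* F)) refl c δ a F G ⟩
    δ * (F + (δ + a) * G) + (c + a * F) ≈⟨ +-congʳ (*-congˡ (+-congˡ (*-congʳ x≈d+a))) ⟩
    δ * (F + x * G) + (c + a * F)       ∎
    where
    δ F G : Carrier
    δ = x - a
    F = eval (d ∷ f) a
    G = eval (quotient (d ∷ f) a) x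
    x≈d+a : δ + a ≈ x
    x≈d+a = //-rightDividesˡ a x

  quotient≈0 : ∀ f a → All (_≈ 0#) (quotient f a) → eval f a ≈ 0# → All (_≈ 0#) f
  quotient≈0 []          a _ _ = []
  quotient≈0 (c ∷ [])    a _ fa≈0 = trans (sym (trans (+-congˡ (zeroʳ a)) (+-identityʳ c))) fa≈0 ∷ []
  quotient≈0 (c ∷ d ∷ f) a (F≈0 ∷ q≈0) fa≈0 = c≈0 ∷ quotient≈0 (d ∷ f) a q≈0 F≈0
    where
    c≈0 : c ≈ 0#
    c≈0 = begin
      c                      ≈⟨ sym (+-identityʳ c) ⟩
      c + 0#                 ≈⟨ +-congˡ (sym (zeroʳ a)) ⟩
      c + a * 0#             ≈⟨ +-congˡ (*-congˡ (sym F≈0)) ⟩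
      c + a * eval (d ∷ f) a ≈⟨ fa≈0 ⟩
      0#                     ∎

  roots⇒zero : ∀ m (pts : Fin m → Carrier) → (∀ i j → pts i ≈ pts j → i ≡ j) →
               ∀ f → length f ≤ m → (∀ i → eval f (pts i) ≈ 0#) → All (_≈ 0#) f
  roots⇒zero zero    pts distinct []      _   _      = []
  roots⇒zero (suc m) pts distinct f       len vanish =
    quotient≈0 f a (roots⇒zero m (λ i → pts (Fin.suc i)) distinct′ (quotient f a) len′ vanish′) (vanish Fin.zero)
    where
    a : Carrier
    a = pts Fin.zero
    distinct′ : ∀ i j → pts (Fin.suc i) ≈ pts (Fin.suc j) → i ≡ j
    distinct′ i j eq = FinP.suc-injective (distinct _ _ eq)
    len′ : length (quotient f a) ≤ m
    len′ = ≡.subst (_≤ m) (≡.sym (length-quotient f a)) (ℕP.pred-mono-≤ len)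
    vanish′ : ∀ i → eval (quotient f a) (pts (Fin.suc i)) ≈ 0#
    vanish′ i = *-cancel-≉0 b-a≉0 (begin
      (b - a) * eval (quotient f a) b            ≈⟨ sym (+-identityʳ _) ⟩
      (b - a) * eval (quotient f a) b + 0#       ≈⟨ +-congˡ (sym (vanish Fin.zero)) ⟩
      (b - a) * eval (quotient f a) b + eval f a ≈⟨ sym (factor-theorem f a b) ⟩
      eval f b                                   ≈⟨ vanish (Fin.suc i) ⟩
      0#                                         ∎)
      where
      b : Carrier
      b = pts (Fin.suc i)
      b-a≉0 : ¬ b - a ≈ 0#
      b-a≉0 b-a≈0 = FinP.0≢1+n (distinct Fin.zero (Fin.suc i) (sym (x∙y⁻¹≈ε⇒x≈y b a b-a≈0)))

module Fermat (K : FiniteField) where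
  open FiniteField K
  open import Relation.Binary.Reasoning.Setoid setoid
  open import Algebra.Properties.Group +-group using (x∙y⁻¹≈ε⇒x≈y)
  open import Algebra.Properties.Ring ring using (-‿distribʳ-*)
  import Algebra.Properties.CommutativeMonoid.Sum *-commutativeMonoid as Product
  open import Data.Fin.Permutation using (Permutation; permutation)
  open Polynomials K using (*-≉0; *-cancel-≉0)
  open Counting using (count-unique; count+count-not)

  ∏ : ∀ {n} → (Fin n → Carrier) → Carrier
  ∏ = Product.sum

  ∏-cong : ∀ {n} {f g : Fin n → Carrier} → (∀ i → f i ≈ g i) → ∏ f ≈ ∏ g
  ∏-cong {zero}  f≈g = refl
  ∏-cong {suc n} f≈g = *-cong (f≈g Fin.zero) (∏-cong (λ i → f≈g (Fin.suc i)))

  ∏-≉0 : ∀ {n} (f : Fin n → Carrier) → (∀ i → ¬ f i ≈ 0#) → ¬ ∏ f ≈ 0#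
  ∏-≉0 {zero}  f f≉0 = 1≉0
  ∏-≉0 {suc n} f f≉0 = *-≉0 (f≉0 Fin.zero) (∏-≉0 (λ i → f (Fin.suc i)) (λ i → f≉0 (Fin.suc i)))

  isZero : Carrier → Bool
  isZero y = does (y ≟ 0#)

  count-isZero : count size (λ i → isZero (enum i)) ≡ 1
  count-isZero with enum-surj 0#
  ... | i₀ , i₀≈0 = count-unique size _ i₀ (dec-true (enum i₀ ≟ 0#) i₀≈0)
    (λ j j≈0 → enum-inj j i₀ (trans (does-true⇒ (enum j ≟ 0#) j≈0) (sym i₀≈0)))

  count-nonzero : count size (λ i → not (isZero (enum i))) ≡ size ∸ 1
  count-nonzero = ≡.trans (≡.sym (ℕP.m+n∸m≡n 1 _)) (≡.cong (_∸ 1) (≡.trans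
    (≡.cong (ℕ._+ count size (λ i → not (isZero (enum i)))) (≡.sym count-isZero))
    (count+count-not size (λ i → isZero (enum i)))))

  size≡1+[size∸1] : size ≡ suc (size ∸ 1)
  size≡1+[size∸1] = inhabited (proj₁ (enum-surj 0#))
    where
    inhabited : ∀ {n} → Fin n → n ≡ suc (n ∸ 1)
    inhabited {suc n} _ = ≡.refl

  -- Multiplication by x ≉ 0 permutes K; comparing the products of `unit` (which replaces 0 by 1)
  -- over K before and after the permutation gives x ^ (q - 1) ≈ 1.
  module _ {x} (x≉0 : ¬ x ≈ 0#) where
    private
      x⁻¹ : Carrier
      x⁻¹ = proj₁ (inv x x≉0)
      xx⁻¹≈1 : x * x⁻¹ ≈ 1#
      xx⁻¹≈1 = proj₂ (inv x x≉0)

      scale : Carrier → Fin size → Fin size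
      scale c i = proj₁ (enum-surj (c * enum i))

      enum-scale : ∀ c i → enum (scale c i) ≈ c * enum i
      enum-scale c i = proj₂ (enum-surj (c * enum i))

      scale-inverse : ∀ {c d} → c * d ≈ 1# → ∀ i → scale c (scale d i) ≡ i
      scale-inverse {c} {d} cd≈1 i = enum-inj _ _ (begin
        enum (scale c (scale d i)) ≈⟨ enum-scale c _ ⟩
        c * enum (scale d i)       ≈⟨ *-congˡ (enum-scale d i) ⟩
        c * (d * enum i)           ≈⟨ sym (*-assoc c d _) ⟩
        (c * d) * enum i           ≈⟨ *-congʳ cd≈1 ⟩
        1# * enum i                ≈⟨ *-identityˡ _ ⟩
        enum i                     ∎)

      scale-x : Permutation size size
      scale-x = permutation (scale x) (scale x⁻¹)
        (scale-inverse xx⁻¹≈1) (scale-inverse (trans (*-comm x⁻¹ x) xx⁻¹≈1))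

      unit : Carrier → Carrier
      unit y with y ≟ 0#
      ... | yes _ = 1#
      ... | no  _ = y

      unit≉0 : ∀ y → ¬ unit y ≈ 0#
      unit≉0 y with y ≟ 0#
      ... | yes _   = 1≉0
      ... | no  y≉0 = y≉0

      unit-cong : ∀ {y z} → y ≈ z → unit y ≈ unit z
      unit-cong {y} {z} y≈z with y ≟ 0# | z ≟ 0#
      ... | yes _   | yes _   = refl
      ... | yes y≈0 | no  z≉0 = ⊥-elim (z≉0 (trans (sym y≈z) y≈0))
      ... | no  y≉0 | yes z≈0 = ⊥-elim (y≉0 (trans y≈z z≈0))
      ... | no  _   | no  _   = y≈z

      factor : Carrier → Carrier
      factor y = if isZero y then 1# else x

      unit-x* : ∀ y → unit (x * y) ≈ factor y * unit y
      unit-x* y with y ≟ 0# | (x * y) ≟ 0#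
      ... | yes _   | yes _    = sym (*-identityˡ 1#)
      ... | yes y≈0 | no  xy≉0 = ⊥-elim (xy≉0 (trans (*-congˡ y≈0) (zeroʳ x)))
      ... | no  y≉0 | yes xy≈0 = ⊥-elim (*-≉0 x≉0 y≉0 xy≈0)
      ... | no  _   | no  _    = refl

      ∏-factor : ∀ {n} (v : Fin n → Carrier) → ∏ (λ i → factor (v i)) ≈ x ^ count n (λ i → not (isZero (v i)))
      ∏-factor {zero}  v = refl
      ∏-factor {suc n} v with isZero (v Fin.zero)
      ... | true  = trans (*-identityˡ _) (∏-factor (λ i → v (Fin.suc i)))
      ... | false = *-congˡ (∏-factor (λ i → v (Fin.suc i)))

      P : Carrier
      P = ∏ (λ i → unit (enum i))

      P≈x^[q-1]*P : P ≈ x ^ (size ∸ 1) * P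
      P≈x^[q-1]*P = begin
        P                                                ≈⟨ Product.∑-permute (λ i → unit (enum i)) scale-x ⟩
        ∏ (λ i → unit (enum (scale x i)))                ≈⟨ ∏-cong (λ i → trans (unit-cong (enum-scale x i)) (unit-x* (enum i))) ⟩
        ∏ (λ i → factor (enum i) * unit (enum i))        ≈⟨ Product.∑-distrib-+ (λ i → factor (enum i)) (λ i → unit (enum i)) ⟩
        ∏ (λ i → factor (enum i)) * P                    ≈⟨ *-congʳ (∏-factor enum) ⟩
        x ^ count size (λ i → not (isZero (enum i))) * P ≡⟨ ≡.cong (λ k → x ^ k * P) count-nonzero ⟩
        x ^ (size ∸ 1) * P                               ∎

    x^[q-1]≈1 : x ^ (size ∸ 1) ≈ 1#
    x^[q-1]≈1 = x∙y⁻¹≈ε⇒x≈y _ _ (*-cancel-≉0 (∏-≉0 _ (λ i → unit≉0 (enum i))) (begin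
      P * (x ^ (size ∸ 1) - 1#)       ≈⟨ distribˡ P _ _ ⟩
      P * x ^ (size ∸ 1) + P * - 1#   ≈⟨ +-cong (*-comm P _) (sym (-‿distribʳ-* P 1#)) ⟩
      x ^ (size ∸ 1) * P + - (P * 1#) ≈⟨ +-cong (sym P≈x^[q-1]*P) (-‿cong (*-identityʳ P)) ⟩
      P - P                           ≈⟨ -‿inverseʳ P ⟩
      0#                              ∎))

  x^q≈x : ∀ x → x ^ size ≈ x
  x^q≈x x with x ≟ 0#
  ... | yes x≈0 = begin
    x ^ size            ≡⟨ ≡.cong (x ^_) size≡1+[size∸1] ⟩
    x * x ^ (size ∸ 1)  ≈⟨ *-congʳ x≈0 ⟩
    0# * x ^ (size ∸ 1) ≈⟨ zeroˡ _ ⟩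
    0#                  ≈⟨ sym x≈0 ⟩
    x                   ∎
  ... | no x≉0 = begin
    x ^ size           ≡⟨ ≡.cong (x ^_) size≡1+[size∸1] ⟩
    x * x ^ (size ∸ 1) ≈⟨ *-congˡ (x^[q-1]≈1 x≉0) ⟩
    x * 1#             ≈⟨ *-identityʳ x ⟩
    x                  ∎

module PrimeSubfield (K : FiniteField) {p} (p-prime : Prime p)
                     (char : FiniteField._≈_ K (FiniteField._·1×_ K p (FiniteField.1# K)) (FiniteField.0# K)) where
  open FiniteField K
  open import Relation.Binary.Reasoning.Setoid setoid
  open import Algebra.Properties.Semiring.Mult semiring using (×-homo-+; ×-homo-1; ×1-homo-*)
  open import Algebra.Properties.Group +-group using (quasigroup)
  open import Algebra.Properties.Quasigroup quasigroup using (cancelˡ)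
  open import Algebra.Properties.Ring ring using (-‿distribˡ-*)
  open Powers commRing using (module Frobenius)
  open Frobenius p-prime char public
  open Polynomials K

  private
    annihilates-* : ∀ a {b} → b ·1× 1# ≈ 0# → (a ℕ.* b) ·1× 1# ≈ 0#
    annihilates-* a {b} b≈0 = trans (×1-homo-* a b) (trans (*-congˡ b≈0) (zeroʳ _))

    1+c-annihilates : ∀ {c} → c ·1× 1# ≈ 0# → ¬ suc c ·1× 1# ≈ 0#
    1+c-annihilates {c} c≈0 1+c≈0 = 1≉0 (begin
      1#                  ≈⟨ sym (×-homo-1 1#) ⟩
      1 ·1× 1#            ≈⟨ sym (+-identityʳ _) ⟩
      1 ·1× 1# + 0#       ≈⟨ +-congˡ (sym c≈0) ⟩
      1 ·1× 1# + c ·1× 1# ≈⟨ sym (×-homo-+ 1# 1 c) ⟩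
      suc c ·1× 1#        ≈⟨ 1+c≈0 ⟩
      0#                  ∎)

  m·1≉0 : ∀ {m} → 0 < m → m < p → ¬ m ·1× 1# ≈ 0#
  m·1≉0 {m@(suc _)} _ m<p m≈0 with coprime-Bézout (prime⇒coprime p-prime m<p)
  ... | Bézout.+- a b 1+bm≡ap = 1+c-annihilates {b ℕ.* m} (annihilates-* b {m} m≈0)
    (≡.subst (λ k → k ·1× 1# ≈ 0#) (≡.sym 1+bm≡ap) (annihilates-* a {p} char))
  ... | Bézout.-+ a b 1+ap≡bm = 1+c-annihilates {a ℕ.* p} (annihilates-* a {p} char)
    (≡.subst (λ k → k ·1× 1# ≈ 0#) (≡.sym 1+ap≡bm) (annihilates-* b {m} m≈0))

  private
    ·1×-injective< : ∀ {i j} → i < j → j < p → ¬ i ·1× 1# ≈ j ·1× 1#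
    ·1×-injective< {i} {j} i<j j<p i≈j = m·1≉0 (ℕP.m<n⇒0<n∸m i<j) (ℕP.≤-<-trans (ℕP.m∸n≤m j i) j<p)
      (cancelˡ (i ·1× 1#) _ _ (begin
        i ·1× 1# + (j ∸ i) ·1× 1# ≈⟨ sym (×-homo-+ 1# i (j ∸ i)) ⟩
        (i ℕ.+ (j ∸ i)) ·1× 1#    ≡⟨ ≡.cong (_·1× 1#) (ℕP.m+[n∸m]≡n (ℕP.<⇒≤ i<j)) ⟩
        j ·1× 1#                  ≈⟨ sym i≈j ⟩
        i ·1× 1#                  ≈⟨ sym (+-identityʳ _) ⟩
        i ·1× 1# + 0#             ∎))

  ·1×-injective : ∀ (i j : Fin p) → toℕ i ·1× 1# ≈ toℕ j ·1× 1# → i ≡ j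
  ·1×-injective i j i≈j with ℕP.<-cmp (toℕ i) (toℕ j)
  ... | tri< i<j _ _ = ⊥-elim (·1×-injective< i<j (FinP.toℕ<n j) i≈j)
  ... | tri≈ _ i≡j _ = FinP.toℕ-injective i≡j
  ... | tri> _ _ j<i = ⊥-elim (·1×-injective< j<i (FinP.toℕ<n i) (sym i≈j))

  X^p-X : Poly
  X^p-X = monomial 1# p ⊕ monomial (- 1#) 1

  eval-X^p-X : ∀ z → z ^ p ≈ z → eval X^p-X z ≈ 0#
  eval-X^p-X z z^p≈z = begin
    eval X^p-X z                                        ≈⟨ eval-⊕ (monomial 1# p) (monomial (- 1#) 1) z ⟩
    eval (monomial 1# p) z + eval (monomial (- 1#) 1) z ≈⟨ +-cong (eval-monomial 1# p z) (eval-monomial (- 1#) 1 z) ⟩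
    1# * z ^ p + - 1# * (z * 1#)
      ≈⟨ +-cong (trans (*-identityˡ _) z^p≈z) (trans (sym (-‿distribˡ-* 1# _)) (-‿cong (trans (*-identityˡ _) (*-identityʳ z)))) ⟩
    z - z ≈⟨ -‿inverseʳ z ⟩
    0#    ∎

  fixed⇒∈𝔽ₚ : ∀ y → y ^ p ≈ y → ∃ λ (t : Fin p) → y ≈ toℕ t ·1× 1#
  fixed⇒∈𝔽ₚ y y^p≈y with FinP.any? (λ (t : Fin p) → y ≟ (toℕ t ·1× 1#))
  ... | yes y∈𝔽ₚ = y∈𝔽ₚ
  ... | no  y∉𝔽ₚ = ⊥-elim (1≉0 (begin
    1#                                                    ≈⟨ sym (+-identityʳ 1#) ⟩
    1# + 0#                                               ≈⟨ sym (+-cong (coeff-monomial-≡ 1# p) (coeff-monomial-≢ (- 1#) 1 p 1≢p)) ⟩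
    coeff (monomial 1# p) p + coeff (monomial (- 1#) 1) p ≈⟨ sym (coeff-⊕ (monomial 1# p) (monomial (- 1#) 1) p) ⟩
    coeff X^p-X p                                         ≈⟨ All≈0⇒coeff≈0 X^p-X p (roots⇒zero (suc p) pts distinct X^p-X length≤ vanish) ⟩
    0#                                                    ∎))
    where
    1≢p : 1 ≢ p
    1≢p = ℕP.<⇒≢ (prime⇒1<p p-prime)
    pts : Fin (suc p) → Carrier
    pts Fin.zero    = y
    pts (Fin.suc t) = toℕ t ·1× 1#
    distinct : ∀ i j → pts i ≈ pts j → i ≡ j
    distinct Fin.zero    Fin.zero    _   = ≡.refl
    distinct Fin.zero    (Fin.suc t) y≈t = ⊥-elim (y∉𝔽ₚ (t , y≈t))
    distinct (Fin.suc s) Fin.zero    s≈y = ⊥-elim (y∉𝔽ₚ (s , sym s≈y))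
    distinct (Fin.suc s) (Fin.suc t) s≈t = ≡.cong Fin.suc (·1×-injective s t s≈t)
    length≤ : length X^p-X ≤ suc p
    length≤ = length-⊕ (monomial 1# p) (monomial (- 1#) 1)
      (length-monomial 1# p ℕP.≤-refl) (length-monomial (- 1#) 1 (s≤s (ℕP.<⇒≤ (prime⇒1<p p-prime))))
    vanish : ∀ i → eval X^p-X (pts i) ≈ 0#
    vanish Fin.zero    = eval-X^p-X y y^p≈y
    vanish (Fin.suc t) = eval-X^p-X _ (·1×-^p (toℕ t))

module TraceUnfolding (K : FiniteField) (p : ℕ) where
  open FiniteField K
  open WeilSum K p using (Tr)

  partialTrace : Carrier → ℕ → Carrier
  partialTrace x zero    = 0#
  partialTrace x (suc k) = partialTrace x k + x ^ (p ℕ.^ k)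

  -- `Tr` recurses through a local function of Defs that cannot be named; `go′` is solved by
  -- unification against it, and abstracting `suc m` keeps that problem in the pattern fragment.
  private
    mutual
      go′ : Carrier → ℕ → ℕ → Carrier
      go′ = _

      Tr-suc : ∀ x m → Tr (suc m) x ≡ go′ x (suc m) m + x ^ (p ℕ.^ m)
      Tr-suc x m with suc m
      ... | _ = ≡.refl

    go′≡partialTrace : ∀ x n k → go′ x n k ≡ partialTrace x k
    go′≡partialTrace x n zero    = ≡.refl
    go′≡partialTrace x n (suc k) = ≡.cong (_+ x ^ (p ℕ.^ k)) (go′≡partialTrace x n k)

  Tr≡partialTrace : ∀ n x → Tr n x ≡ partialTrace x n
  Tr≡partialTrace zero    x = ≡.refl
  Tr≡partialTrace (suc m) x = ≡.trans (Tr-suc x m) (≡.cong (_+ x ^ (p ℕ.^ m)) (go′≡partialTrace x (suc m) m))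

module Trace (K : FiniteField) {p} (p-prime : Prime p)
             (char : FiniteField._≈_ K (FiniteField._·1×_ K p (FiniteField.1# K)) (FiniteField.0# K))
             (n : ℕ) (size≡pⁿ : FiniteField.size K ≡ p ℕ.^ n) where
  open FiniteField K
  open import Relation.Binary.Reasoning.Setoid setoid
  open import Algebra.Properties.Semiring.Exp semiring using (^-congˡ; ^-assocʳ)
  open import Algebra.Properties.Group +-group using (quasigroup)
  open import Algebra.Properties.Quasigroup quasigroup using (cancelʳ)
  open import Algebra.Properties.CommutativeSemigroup +-commutativeSemigroup using (x∙yz≈xy∙z)
  open PrimeSubfield K p-prime char
  open Powers commRing using (0^n≈0)
  open TraceUnfolding K p public
  open WeilSum K p n using (Tr)

  x^pⁿ≈x : ∀ x → x ^ (p ℕ.^ n) ≈ x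
  x^pⁿ≈x x = trans (reflexive (≡.cong (x ^_) (≡.sym size≡pⁿ))) (Fermat.x^q≈x K x)

  partialTrace-cong : ∀ {x y} k → x ≈ y → partialTrace x k ≈ partialTrace y k
  partialTrace-cong zero    x≈y = refl
  partialTrace-cong (suc k) x≈y = +-cong (partialTrace-cong k x≈y) (^-congˡ (p ℕ.^ k) x≈y)

  partialTrace-0 : ∀ k → partialTrace 0# k ≈ 0#
  partialTrace-0 zero    = refl
  partialTrace-0 (suc k) = trans (+-cong (partialTrace-0 k) 0^pᵏ≈0) (+-identityʳ 0#)
    where
    0^pᵏ≈0 : 0# ^ (p ℕ.^ k) ≈ 0#
    0^pᵏ≈0 = 0^n≈0 (p ℕ.^ k) {{ℕP.m^n≢0 p k {{prime⇒nonZero p-prime}}}}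

  partialTrace-^p : ∀ x k → partialTrace x k ^ p ≈ partialTrace (x ^ p) k
  partialTrace-^p x zero    = 0^p≈0
  partialTrace-^p x (suc k) = trans (frobenius-+ _ _) (+-cong (partialTrace-^p x k) (begin
    (x ^ (p ℕ.^ k)) ^ p ≈⟨ ^-assocʳ x (p ℕ.^ k) p ⟩
    x ^ (p ℕ.^ k ℕ.* p) ≡⟨ ≡.cong (x ^_) (ℕP.*-comm (p ℕ.^ k) p) ⟩
    x ^ (p ℕ.* p ℕ.^ k) ≈⟨ sym (^-assocʳ x p (p ℕ.^ k)) ⟩
    (x ^ p) ^ (p ℕ.^ k) ∎))

  partialTrace-shift : ∀ x k → x + partialTrace (x ^ p) k ≈ partialTrace x k + x ^ (p ℕ.^ k)
  partialTrace-shift x zero    = trans (+-comm x 0#) (+-congˡ (sym (*-identityʳ x)))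
  partialTrace-shift x (suc k) = begin
    x + (partialTrace (x ^ p) k + (x ^ p) ^ (p ℕ.^ k))     ≈⟨ x∙yz≈xy∙z x _ _ ⟩
    (x + partialTrace (x ^ p) k) + (x ^ p) ^ (p ℕ.^ k)     ≈⟨ +-cong (partialTrace-shift x k) (^-assocʳ x p (p ℕ.^ k)) ⟩
    (partialTrace x k + x ^ (p ℕ.^ k)) + x ^ (p ℕ.^ suc k) ∎

  Tr^p≈Tr : ∀ x → Tr x ^ p ≈ Tr x
  Tr^p≈Tr x rewrite Tr≡partialTrace n x = begin
    partialTrace x n ^ p   ≈⟨ partialTrace-^p x n ⟩
    partialTrace (x ^ p) n ≈⟨ cancelʳ x _ _ (trans (+-comm _ x) (trans (partialTrace-shift x n) (+-congˡ (x^pⁿ≈x x)))) ⟩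
    partialTrace x n       ∎

  Tr∈𝔽ₚ : ∀ x → ∃ λ (t : Fin p) → Tr x ≈ toℕ t ·1× 1#
  Tr∈𝔽ₚ x = fixed⇒∈𝔽ₚ (Tr x) (Tr^p≈Tr x)

  Tr-cong : ∀ {x y} → x ≈ y → Tr x ≈ Tr y
  Tr-cong {x} {y} x≈y rewrite Tr≡partialTrace n x | Tr≡partialTrace n y = partialTrace-cong n x≈y

  Tr-0 : Tr 0# ≈ 0#
  Tr-0 = trans (reflexive (Tr≡partialTrace n 0#)) (partialTrace-0 n)

module WeilCounts (K : FiniteField) {p} (p-prime : Prime p)
                  (char : FiniteField._≈_ K (FiniteField._·1×_ K p (FiniteField.1# K)) (FiniteField.0# K))
                  (n : ℕ) (size≡pⁿ : FiniteField.size K ≡ p ℕ.^ n) (s : ℕ) (u : FiniteField.Carrier K) where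
  open FiniteField K
  open import Relation.Binary.Reasoning.Setoid setoid
  open import Algebra.Properties.Semiring.Exp semiring using (^-congˡ)
  open PrimeSubfield K p-prime char using (·1×-injective)
  open Powers commRing using (0^n≈0)
  open Trace K p-prime char n size≡pⁿ
  open WeilSum K p n using (Tr; N)
  open Counting using (∑-count-partition; count-unique; count-pos)

  f : Carrier → Carrier
  f x = x ^ s - u * x

  ∑N≡q : ∑[ t < p ] N s u t ≡ size
  ∑N≡q = ∑-count-partition p size _ λ i →
    let t , Tr≈t = Tr∈𝔽ₚ (f (enum i)) in
    count-unique p _ t (dec-true (Tr (f (enum i)) ≟ _) Tr≈t)
      (λ t′ Tr≈t′ → ·1×-injective t′ t (trans (sym (does-true⇒ (Tr (f (enum i)) ≟ _) Tr≈t′)) Tr≈t))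

  1≤N₀ : 0 < s → ∀ (t : Fin p) → toℕ t ≡ 0 → 1 ≤ N s u t
  1≤N₀ 0<s t t≡0 = count-pos size _ i₀ (dec-true (Tr (f (enum i₀)) ≟ _) (begin
    Tr (f (enum i₀)) ≈⟨ Tr-cong f[i₀]≈0 ⟩
    Tr 0#            ≈⟨ Tr-0 ⟩
    0#               ≡⟨ ≡.cong (_·1× 1#) (≡.sym t≡0) ⟩
    toℕ t ·1× 1#     ∎))
    where
    i₀ : Fin size
    i₀ = proj₁ (enum-surj 0#)
    i₀≈0 : enum i₀ ≈ 0#
    i₀≈0 = proj₂ (enum-surj 0#)
    f[i₀]≈0 : f (enum i₀) ≈ 0#
    f[i₀]≈0 = begin
      enum i₀ ^ s - u * enum i₀ ≈⟨ +-cong (^-congˡ s i₀≈0) (-‿cong (trans (*-congˡ i₀≈0) (zeroʳ u))) ⟩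
      0# ^ s - 0#               ≈⟨ +-congʳ (0^n≈0 s {{ℕ.>-nonZero 0<s}}) ⟩
      0# - 0#                   ≈⟨ -‿inverseʳ 0# ⟩
      0#                        ∎

module ExponentReduction (Q : ℕ) .{{Q≢0 : ℕ.NonZero Q}} where
  open import Data.Nat.Base using (_+_; _*_; _%_; _/_)
  open ≡ using (refl; sym; trans; cong; subst)

  reduce : ℕ → ℕ
  reduce a = suc ((a ∸ 1) % Q)

  reduce≤Q : ∀ a → reduce a ≤ Q
  reduce≤Q a = m%n<n (a ∸ 1) Q

  reduce-id : ∀ {a} → 1 ≤ a → a ≤ Q → reduce a ≡ a
  reduce-id {suc a} _ a<Q = cong suc (m<n⇒m%n≡m a<Q)

  reduce+multiple : ∀ a → 1 ≤ a → a ≡ reduce a + (a ∸ 1) / Q * Q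
  reduce+multiple (suc a) _ = cong suc (m≡m%n+[m/n]*n a Q)

  reduce-≡⇒∣∸ : ∀ a {b} → 1 ≤ b → reduce a ≡ reduce b → Q ∣ a ∸ b
  reduce-≡⇒∣∸ a {b} 1≤b eq = subst (Q ∣_) [a∸1]∸[b∸1]≡a∸b (%≡%⇒∣∸ Q (a ∸ 1) (b ∸ 1) (ℕP.suc-injective eq))
    where
    [a∸1]∸[b∸1]≡a∸b : (a ∸ 1) ∸ (b ∸ 1) ≡ a ∸ b
    [a∸1]∸[b∸1]≡a∸b = trans (ℕP.∸-+-assoc a 1 (b ∸ 1)) (cong (a ∸_) (ℕP.m+[n∸m]≡n 1≤b))

  ∣∸∧∣∸⇒∣∣⊖∣ : ∀ a b → Q ∣ a ∸ b → Q ∣ b ∸ a → Q ∣ ℤ.∣ a ℤ.⊖ b ∣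
  ∣∸∧∣∸⇒∣∣⊖∣ a b Q∣a∸b Q∣b∸a with ℕP.≤-total a b
  ... | inj₁ a≤b = subst (Q ∣_) (sym (ℤP.∣⊖∣-≤ a≤b)) Q∣b∸a
  ... | inj₂ b≤a = subst (Q ∣_) (sym (trans (ℤP.∣m⊖n∣≡∣n⊖m∣ a b) (ℤP.∣⊖∣-≤ b≤a))) Q∣a∸b

module TraceExponents {p n : ℕ} (1<p : 1 < p) (1≤n : 1 ≤ n) where
  open import Data.Nat.Base using (_+_; _*_; _^_)
  open ≡ using (refl; sym; trans; cong; subst)

  instance
    p-nonZero : ℕ.NonZero p
    p-nonZero = ℕ.>-nonZero (ℕP.<-trans (s≤s z≤n) 1<p)

  Q : ℕ
  Q = p ^ n ∸ 1

  pᵏ<pⁿ : ∀ {k} → k < n → p ^ k < p ^ n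
  pᵏ<pⁿ = ℕP.^-monoʳ-< p 1<p

  pᵏ≤Q : ∀ {k} → k < n → p ^ k ≤ Q
  pᵏ≤Q k<n = <⇒≤∸1 (pᵏ<pⁿ k<n)
    where
    <⇒≤∸1 : ∀ {a b} → a < b → a ≤ b ∸ 1
    <⇒≤∸1 (s≤s a≤b) = a≤b

  instance
    Q-nonZero : ℕ.NonZero Q
    Q-nonZero = ℕ.>-nonZero (ℕP.≤-trans (ℕP.m^n>0 p 0) (pᵏ≤Q 1≤n))

  open ExponentReduction Q public

  1≤pᵏ : ∀ k → 1 ≤ p ^ k
  1≤pᵏ k = ℕP.m^n>0 p k

  reduce-s·pᵏ≢reduce-s : ∀ {s k} → 0 < s → gcd s Q ≡ 1 → 1 ≤ k → k < n → reduce (s * p ^ k) ≢ reduce s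
  reduce-s·pᵏ≢reduce-s {s} {k} 0<s gcd≡1 1≤k k<n eq = ℕP.<⇒≱ pᵏ∸1<Q (∣⇒≤ {{pᵏ∸1≢0}} Q∣pᵏ∸1)
    where
    pᵏ∸1≢0 : ℕ.NonZero (p ^ k ∸ 1)
    pᵏ∸1≢0 = ℕ.>-nonZero (ℕP.∸-monoˡ-≤ 1 (ℕP.≤-trans 1<p
      (ℕP.≤-trans (ℕP.≤-reflexive (sym (ℕP.*-identityʳ p))) (ℕP.^-monoʳ-≤ p 1≤k))))
    pᵏ∸1<Q : p ^ k ∸ 1 < Q
    pᵏ∸1<Q = ℕP.∸-monoˡ-< (pᵏ<pⁿ k<n) (1≤pᵏ k)
    Q∣s·[pᵏ∸1] : Q ∣ s * (p ^ k ∸ 1)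
    Q∣s·[pᵏ∸1] = subst (Q ∣_)
      (trans (cong (s * p ^ k ∸_) (sym (ℕP.*-identityʳ s))) (sym (ℕP.*-distribˡ-∸ s (p ^ k) 1)))
      (reduce-≡⇒∣∸ (s * p ^ k) 0<s eq)
    Q∣pᵏ∸1 : Q ∣ p ^ k ∸ 1
    Q∣pᵏ∸1 = coprime-divisor (Coprime.sym (gcd≡1⇒coprime {s} {Q} gcd≡1)) Q∣s·[pᵏ∸1]

  pᵏ≢reduce-s : ∀ {s k} → 0 < s → Nondegenerate p (p ^ n) s → k < n → p ^ k ≢ reduce s
  pᵏ≢reduce-s {s} {k} 0<s nondegenerate k<n eq = nondegenerate k (subst (Q ∣_)
    (cong ℤ.∣_∣ (sym (ℤP.m-n≡m⊖n s (p ^ k))))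
    (∣∸∧∣∸⇒∣∣⊖∣ s (p ^ k) (reduce-≡⇒∣∸ s (1≤pᵏ k) (sym eq′)) (reduce-≡⇒∣∸ (p ^ k) 0<s eq′)))
    where
    eq′ : reduce (p ^ k) ≡ reduce s
    eq′ = trans (reduce-id (1≤pᵏ k) (pᵏ≤Q k<n)) eq

module TracePolynomial (K : FiniteField) {p} (p-prime : Prime p)
                       (char : FiniteField._≈_ K (FiniteField._·1×_ K p (FiniteField.1# K)) (FiniteField.0# K))
                       {n} (1≤n : 1 ≤ n) (size≡pⁿ : FiniteField.size K ≡ p ℕ.^ n)
                       (s : ℕ) (u : FiniteField.Carrier K) where
  open FiniteField K
  open import Relation.Binary.Reasoning.Setoid setoid
  open import Algebra.Properties.Semiring.Exp semiring using (^-congˡ; ^-homo-*; ^-assocʳ)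
  open import Algebra.Properties.CommutativeSemiring.Exp commutativeSemiring using (^-distrib-*)
  open import Algebra.Properties.Ring ring using (-‿distribˡ-*)
  open PrimeSubfield K p-prime char using (frobenius^-+; frobenius^-neg)
  open Trace K p-prime char n size≡pⁿ using (partialTrace; Tr≡partialTrace; x^pⁿ≈x)
  open TraceExponents (prime⇒1<p p-prime) 1≤n
  open Polynomials K
  open WeilCounts K p-prime char n size≡pⁿ s u using (f)

  private
    Q+1≡pⁿ : suc Q ≡ p ℕ.^ n
    Q+1≡pⁿ = ℕP.m+[n∸m]≡n (ℕP.m^n>0 p n)

  x^[r+Q]≈x^r : ∀ x r → 1 ≤ r → x ^ (r ℕ.+ Q) ≈ x ^ r
  x^[r+Q]≈x^r x (suc r) _ = begin
    x ^ (suc r ℕ.+ Q)     ≡⟨ ≡.cong (x ^_) (≡.trans (≡.sym (ℕP.+-suc r Q)) (≡.cong (r ℕ.+_) Q+1≡pⁿ)) ⟩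
    x ^ (r ℕ.+ p ℕ.^ n)   ≈⟨ ^-homo-* x r (p ℕ.^ n) ⟩
    x ^ r * x ^ (p ℕ.^ n) ≈⟨ *-congˡ (x^pⁿ≈x x) ⟩
    x ^ r * x             ≈⟨ *-comm _ _ ⟩
    x * x ^ r             ∎

  x^[r+m*Q]≈x^r : ∀ x r m → 1 ≤ r → x ^ (r ℕ.+ m ℕ.* Q) ≈ x ^ r
  x^[r+m*Q]≈x^r x r zero    1≤r = reflexive (≡.cong (x ^_) (ℕP.+-identityʳ r))
  x^[r+m*Q]≈x^r x r (suc m) 1≤r = begin
    x ^ (r ℕ.+ (Q ℕ.+ m ℕ.* Q)) ≡⟨ ≡.cong (x ^_) (x∙yz≈xz∙y r Q (m ℕ.* Q)) ⟩
    x ^ ((r ℕ.+ m ℕ.* Q) ℕ.+ Q) ≈⟨ x^[r+Q]≈x^r x _ (ℕP.≤-trans 1≤r (ℕP.m≤m+n r _)) ⟩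
    x ^ (r ℕ.+ m ℕ.* Q)         ≈⟨ x^[r+m*Q]≈x^r x r m 1≤r ⟩
    x ^ r                       ∎
    where open import Algebra.Properties.CommutativeSemigroup ℕP.+-commutativeSemigroup using (x∙yz≈xz∙y)

  x^a≈x^reduce-a : ∀ x a → 1 ≤ a → x ^ a ≈ x ^ reduce a
  x^a≈x^reduce-a x a 1≤a = begin
    x ^ a                                  ≡⟨ ≡.cong (x ^_) (reduce+multiple a 1≤a) ⟩
    x ^ (reduce a ℕ.+ (a ∸ 1) ℕ./ Q ℕ.* Q) ≈⟨ x^[r+m*Q]≈x^r x (reduce a) ((a ∸ 1) ℕ./ Q) (s≤s z≤n) ⟩
    x ^ reduce a                           ∎

  -- By Frobenius, Tr (f x) = Σₖ (x ^ (s pᵏ) - u ^ pᵏ x ^ pᵏ); as x ^ q = x, each exponent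
  -- s pᵏ may be replaced by its representative in [1, q - 1], so the polynomial has length ≤ q.
  term : ℕ → Poly
  term k = monomial 1# (reduce (s ℕ.* p ℕ.^ k)) ⊕ monomial (- (u ^ (p ℕ.^ k))) (p ℕ.^ k)

  tracePoly : ℕ → Poly
  tracePoly zero    = []
  tracePoly (suc k) = tracePoly k ⊕ term k

  module _ (0<s : 0 < s) where

    eval-term : ∀ k x → eval (term k) x ≈ f x ^ (p ℕ.^ k)
    eval-term k x = begin
      eval (term k) x
        ≈⟨ eval-⊕ (monomial 1# (reduce (s ℕ.* pᵏ))) (monomial (- (u ^ pᵏ)) pᵏ) x ⟩
      eval (monomial 1# (reduce (s ℕ.* pᵏ))) x + eval (monomial (- (u ^ pᵏ)) pᵏ) x
        ≈⟨ +-cong (eval-monomial 1# (reduce (s ℕ.* pᵏ)) x) (eval-monomial (- (u ^ pᵏ)) pᵏ x) ⟩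
      1# * x ^ reduce (s ℕ.* pᵏ) + - (u ^ pᵏ) * x ^ pᵏ
        ≈⟨ +-cong (*-identityˡ _) (sym (-‿distribˡ-* _ _)) ⟩
      x ^ reduce (s ℕ.* pᵏ) - u ^ pᵏ * x ^ pᵏ
        ≈⟨ +-cong (sym (trans (^-assocʳ x s pᵏ) (x^a≈x^reduce-a x (s ℕ.* pᵏ) (ℕP.*-mono-≤ 0<s (1≤pᵏ k)))))
                  (-‿cong (sym (^-distrib-* u x pᵏ))) ⟩
      (x ^ s) ^ pᵏ - (u * x) ^ pᵏ
        ≈⟨ +-congˡ (sym (frobenius^-neg k (u * x))) ⟩
      (x ^ s) ^ pᵏ + (- (u * x)) ^ pᵏ
        ≈⟨ sym (frobenius^-+ k (x ^ s) (- (u * x))) ⟩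
      f x ^ pᵏ
        ∎
      where
      pᵏ : ℕ
      pᵏ = p ℕ.^ k

    eval-tracePoly : ∀ k x → eval (tracePoly k) x ≈ partialTrace (f x) k
    eval-tracePoly zero    x = refl
    eval-tracePoly (suc k) x = trans (eval-⊕ (tracePoly k) (term k) x) (+-cong (eval-tracePoly k x) (eval-term k x))

  length-term : ∀ k → k < n → length (term k) ≤ size
  length-term k k<n = length-⊕ (monomial 1# (reduce (s ℕ.* p ℕ.^ k))) (monomial (- (u ^ (p ℕ.^ k))) (p ℕ.^ k))
    (length-monomial 1# _ (≡.subst (reduce (s ℕ.* p ℕ.^ k) <_) Q+1≡size (s≤s (reduce≤Q (s ℕ.* p ℕ.^ k)))))
    (length-monomial _ (p ℕ.^ k) (≡.subst (p ℕ.^ k <_) (≡.sym size≡pⁿ) (pᵏ<pⁿ k<n)))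
    where
    Q+1≡size : suc Q ≡ size
    Q+1≡size = ≡.trans Q+1≡pⁿ (≡.sym size≡pⁿ)

  length-tracePoly : ∀ k → k ≤ n → length (tracePoly k) ≤ size
  length-tracePoly zero    _   = z≤n
  length-tracePoly (suc k) k<n = length-⊕ (tracePoly k) (term k) (length-tracePoly k (ℕP.<⇒≤ k<n)) (length-term k k<n)

  -- gcd (s, q - 1) = 1 separates reduce s from every reduce (s pᵏ) with 1 ≤ k < n, and
  -- nondegeneracy separates it from every pᵏ.
  module _ (0<s : 0 < s) (gcd≡1 : gcd s Q ≡ 1) (nondegenerate : Nondegenerate p (p ℕ.^ n) s) where

    coeff-term₀ : coeff (term 0) (reduce s) ≈ 1#
    coeff-term₀ = begin
      coeff (term 0) (reduce s)
        ≈⟨ coeff-⊕ (monomial 1# (reduce (s ℕ.* 1))) (monomial (- (u ^ 1)) 1) (reduce s) ⟩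
      coeff (monomial 1# (reduce (s ℕ.* 1))) (reduce s) + coeff (monomial (- (u ^ 1)) 1) (reduce s)
        ≈⟨ +-cong (reflexive (≡.cong (λ e → coeff (monomial 1# (reduce e)) (reduce s)) (ℕP.*-identityʳ s)))
                  (coeff-monomial-≢ _ 1 (reduce s) (pᵏ≢reduce-s 0<s nondegenerate 1≤n)) ⟩
      coeff (monomial 1# (reduce s)) (reduce s) + 0#
        ≈⟨ +-identityʳ _ ⟩
      coeff (monomial 1# (reduce s)) (reduce s)
        ≈⟨ coeff-monomial-≡ 1# (reduce s) ⟩
      1#
        ∎

    coeff-term : ∀ k → 1 ≤ k → k < n → coeff (term k) (reduce s) ≈ 0#
    coeff-term k 1≤k k<n = begin
      coeff (term k) (reduce s)
        ≈⟨ coeff-⊕ (monomial 1# (reduce (s ℕ.* p ℕ.^ k))) (monomial (- (u ^ (p ℕ.^ k))) (p ℕ.^ k)) (reduce s) ⟩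
      coeff (monomial 1# (reduce (s ℕ.* p ℕ.^ k))) (reduce s) + coeff (monomial (- (u ^ (p ℕ.^ k))) (p ℕ.^ k)) (reduce s)
        ≈⟨ +-cong (coeff-monomial-≢ 1# _ (reduce s) (reduce-s·pᵏ≢reduce-s 0<s gcd≡1 1≤k k<n))
                  (coeff-monomial-≢ _ (p ℕ.^ k) (reduce s) (pᵏ≢reduce-s 0<s nondegenerate k<n)) ⟩
      0# + 0#
        ≈⟨ +-identityʳ 0# ⟩
      0#
        ∎

    coeff-tracePoly : ∀ k → 1 ≤ k → k ≤ n → coeff (tracePoly k) (reduce s) ≈ 1#
    coeff-tracePoly (suc zero)    _ _   = coeff-term₀
    coeff-tracePoly (suc (suc k)) _ k<n = begin
      coeff (tracePoly (suc k) ⊕ term (suc k)) (reduce s)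
        ≈⟨ coeff-⊕ (tracePoly (suc k)) (term (suc k)) (reduce s) ⟩
      coeff (tracePoly (suc k)) (reduce s) + coeff (term (suc k)) (reduce s)
        ≈⟨ +-cong (coeff-tracePoly (suc k) (s≤s z≤n) (ℕP.<⇒≤ k<n)) (coeff-term (suc k) (s≤s z≤n) k<n) ⟩
      1# + 0#
        ≈⟨ +-identityʳ 1# ⟩
      1#
        ∎

  N₀≢q : 0 < s → gcd s (size ∸ 1) ≡ 1 → Nondegenerate p size s →
         ∀ (t : Fin p) → toℕ t ≡ 0 → WeilSum.N K p n s u t ≢ size
  N₀≢q 0<s gcd≡1 nondegenerate t t≡0 N₀≡q = 1≉0 (begin
    1#                             ≈⟨ sym (coeff-tracePoly 0<s gcd[s,Q]≡1 nondegenerate′ n 1≤n ℕP.≤-refl) ⟩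
    coeff (tracePoly n) (reduce s) ≈⟨ All≈0⇒coeff≈0 (tracePoly n) (reduce s) tracePoly≈0 ⟩
    0#                             ∎)
    where
    open WeilSum K p n using (Tr)
    gcd[s,Q]≡1 : gcd s Q ≡ 1
    gcd[s,Q]≡1 = ≡.subst (λ q → gcd s (q ∸ 1) ≡ 1) size≡pⁿ gcd≡1
    nondegenerate′ : Nondegenerate p (p ℕ.^ n) s
    nondegenerate′ = ≡.subst (λ q → Nondegenerate p q s) size≡pⁿ nondegenerate
    vanish : ∀ i → eval (tracePoly n) (enum i) ≈ 0#
    vanish i = begin
      eval (tracePoly n) (enum i) ≈⟨ eval-tracePoly 0<s n (enum i) ⟩
      partialTrace (f (enum i)) n ≡⟨ ≡.sym (Tr≡partialTrace n (f (enum i))) ⟩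
      Tr (f (enum i))             ≈⟨ does-true⇒ (Tr (f (enum i)) ≟ _) (Counting.count≡n⇒all size _ N₀≡q i) ⟩
      toℕ t ·1× 1#                ≡⟨ ≡.cong (_·1× 1#) t≡0 ⟩
      0#                          ∎
    tracePoly≈0 : All (_≈ 0#) (tracePoly n)
    tracePoly≈0 = roots⇒zero size enum enum-inj (tracePoly n) (length-tracePoly n ℕP.≤-refl) vanish

module IntegerEmbedding where
  open import Data.Integer.Solver using (module +-*-Solver)
  open +-*-Solver using (solve; _:+_; _:*_; _:=_; con)
  open import Data.Rational.Unnormalised as ℚᵘ using (mkℚᵘ; *≡*)
  import Data.Rational.Unnormalised.Properties as ℚᵘP
  open ≡ using (refl; sym; trans; cong)

  fromℤ : ℤ → ℚ
  fromℤ i = i ℚ./ 1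

  private
    toℚᵘ-fromℤ : ∀ i → ℚ.toℚᵘ (fromℤ i) ℚᵘ.≃ mkℚᵘ i 0
    toℚᵘ-fromℤ i = ℚP.toℚᵘ-fromℚᵘ (mkℚᵘ i 0)

  fromℤ-injective : ∀ {i j} → fromℤ i ≡ fromℤ j → i ≡ j
  fromℤ-injective {i} {j} eq
    with ℚᵘP.≃-trans (ℚᵘP.≃-sym (toℚᵘ-fromℤ i)) (ℚᵘP.≃-trans (ℚᵘP.≃-reflexive (cong ℚ.toℚᵘ eq)) (toℚᵘ-fromℤ j))
  ... | *≡* i*1≡j*1 = trans (sym (ℤP.*-identityʳ i)) (trans i*1≡j*1 (ℤP.*-identityʳ j))

  fromℤ-+ : ∀ i j → fromℤ i ℚ.+ fromℤ j ≡ fromℤ (i ℤ.+ j)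
  fromℤ-+ i j = ℚP.toℚᵘ-injective (ℚᵘP.≃-trans (ℚP.toℚᵘ-homo-+ (fromℤ i) (fromℤ j))
    (ℚᵘP.≃-trans (ℚᵘP.+-cong (toℚᵘ-fromℤ i) (toℚᵘ-fromℤ j))
    (ℚᵘP.≃-trans (*≡* (solve 2 (λ i j → (i :* con (ℤ.+ 1) :+ j :* con (ℤ.+ 1)) :* con (ℤ.+ 1) := (i :+ j) :* con (ℤ.+ 1)) refl i j))
    (ℚᵘP.≃-sym (toℚᵘ-fromℤ (i ℤ.+ j))))))

  fromℤ-* : ∀ i j → fromℤ i ℚ.* fromℤ j ≡ fromℤ (i ℤ.* j)
  fromℤ-* i j = ℚP.toℚᵘ-injective (ℚᵘP.≃-trans (ℚP.toℚᵘ-homo-* (fromℤ i) (fromℤ j))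
    (ℚᵘP.≃-trans (ℚᵘP.*-cong (toℚᵘ-fromℤ i) (toℚᵘ-fromℤ j)) (ℚᵘP.≃-sym (toℚᵘ-fromℤ (i ℤ.* j)))))

  fromℤ-neg : ∀ i → ℚ.- fromℤ i ≡ fromℤ (ℤ.- i)
  fromℤ-neg i = ℚP.toℚᵘ-injective (ℚᵘP.≃-trans (ℚP.toℚᵘ-homo‿- (fromℤ i))
    (ℚᵘP.≃-trans (ℚᵘP.-‿cong (toℚᵘ-fromℤ i)) (ℚᵘP.≃-sym (toℚᵘ-fromℤ (ℤ.- i)))))

  fromℤ-- : ∀ i j → fromℤ i ℚ.- fromℤ j ≡ fromℤ (i ℤ.- j)
  fromℤ-- i j = trans (cong (fromℤ i ℚ.+_) (fromℤ-neg j)) (fromℤ-+ i (ℤ.- j))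

module QuadraticWeilSum {p₁ h : ℕ} (p-prime : Prime (suc p₁)) (p₁≡2h : p₁ ≡ 2 ℕ.* h) (1≤h : 1 ≤ h)
                        (N : Fin (suc p₁) → ℕ) where
  open QuadraticResidues {h = h} p-prime p₁≡2h
  open IntegerEmbedding
  open Counting using (∑-if)
  open import Data.Integer.Base using (+_; -_; _+_; _-_; _*_)
  open import Data.Integer.Solver using (module +-*-Solver)
  open +-*-Solver using (solve; _:+_; _:-_; _:*_; _:=_; :-_; con)
  open import Algebra.Properties.Group ℚP.+-0-group using (quasigroup)
  open import Algebra.Properties.Quasigroup quasigroup using (cancelʳ)
  open ≡ using (refl; sym; trans; cong; cong₂; subst)

  pos-p : + p ≡ + 1 + + 2 * + h
  pos-p = trans (ℤP.pos-+ 1 p₁) (cong (_+_ (+ 1)) (trans (cong +_ p₁≡2h) (ℤP.pos-* 2 h)))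

  W′ : Cyc p
  W′ t = fromℤ (+ N t)

  sign : Bool → ℤ
  sign b = if b then + 1 else - + 1

  embedℤ : ℤ → Fin p → ℤ
  embedℤ I Fin.zero    = I
  embedℤ I (Fin.suc _) = + 0

  value : ℤ → ℤ → Fin p → ℤ
  value I J t = + 2 * + N t - (embedℤ I t + J * legendre p t)

  embed-fromℤ : ∀ I t → embed (fromℤ I) t ≡ fromℤ (embedℤ I t)
  embed-fromℤ I Fin.zero    = refl
  embed-fromℤ I (Fin.suc _) = refl

  fromℤ-value : ∀ I J t → (fromℤ (+ 2) ·ᶜ W′) t ℚ.- (embed (fromℤ I) +ᶜ (fromℤ J ·ᶜ sqrtp p)) t ≡ fromℤ (value I J t)
  fromℤ-value I J t = begin
    fromℤ (+ 2) ℚ.* fromℤ (+ N t) ℚ.- (embed (fromℤ I) t ℚ.+ fromℤ J ℚ.* fromℤ (legendre p t))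
      ≡⟨ cong₂ ℚ._-_ (fromℤ-* (+ 2) (+ N t)) (cong₂ ℚ._+_ (embed-fromℤ I t) (fromℤ-* J (legendre p t))) ⟩
    fromℤ (+ 2 * + N t) ℚ.- (fromℤ (embedℤ I t) ℚ.+ fromℤ (J * legendre p t))
      ≡⟨ cong (ℚ._-_ (fromℤ (+ 2 * + N t))) (fromℤ-+ (embedℤ I t) (J * legendre p t)) ⟩
    fromℤ (+ 2 * + N t) ℚ.- fromℤ (embedℤ I t + J * legendre p t)
      ≡⟨ fromℤ-- (+ 2 * + N t) (embedℤ I t + J * legendre p t) ⟩
    fromℤ (value I J t)
      ∎
    where open ≡-Reasoning

  module InQuadraticField {a b : ℚ} (W≈a+b√p : W′ ≈ᶜ (embed a +ᶜ (b ·ᶜ sqrtp p))) where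

    private
      b·χ : Fin p₁ → ℚ
      b·χ r = ℚ.0ℚ ℚ.+ b ℚ.* fromℤ (sign (isResidue r))

      N-b·χ≡c : ∀ r → fromℤ (+ N (Fin.suc r)) ℚ.- b·χ r ≡ proj₁ W≈a+b√p
      N-b·χ≡c r = proj₂ W≈a+b√p (Fin.suc r)

    -- Coefficients of ζᵗ, t ≠ 0, differ by the same constant on both sides, and the right side
    -- only sees the character of t.
    N-constant-on-classes : ∀ r r′ → isResidue r ≡ isResidue r′ → N (Fin.suc r) ≡ N (Fin.suc r′)
    N-constant-on-classes r r′ same = ℤP.+-injective (fromℤ-injective (cancelʳ (ℚ.- b·χ r) _ _ (begin
      fromℤ (+ N (Fin.suc r)) ℚ.- b·χ r   ≡⟨ N-b·χ≡c r ⟩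
      proj₁ W≈a+b√p                       ≡⟨ sym (N-b·χ≡c r′) ⟩
      fromℤ (+ N (Fin.suc r′)) ℚ.- b·χ r′ ≡⟨ cong (λ B → fromℤ (+ N (Fin.suc r′)) ℚ.- (ℚ.0ℚ ℚ.+ b ℚ.* fromℤ (sign B)))
                                                    (sym same) ⟩
      fromℤ (+ N (Fin.suc r′)) ℚ.- b·χ r  ∎)))
      where open ≡-Reasoning

    r₊ r₋ : Fin p₁
    r₊ = proj₁ (residue 1≤h)
    r₋ = proj₁ (nonresidue 1≤h)

    N₊ N₋ N₀ S : ℕ
    N₊ = N (Fin.suc r₊)
    N₋ = N (Fin.suc r₋)
    N₀ = N Fin.zero
    S = N₊ ℕ.+ N₋

    N-suc : ∀ r → N (Fin.suc r) ≡ (if isResidue r then N₊ else N₋)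
    N-suc r with isResidue r in class
    ... | true  = N-constant-on-classes r r₊ (trans class (sym (proj₂ (residue 1≤h))))
    ... | false = N-constant-on-classes r r₋ (trans class (sym (proj₂ (nonresidue 1≤h))))

    ∑N≡N₀+h·S : ∑[ t < p ] N t ≡ N₀ ℕ.+ h ℕ.* S
    ∑N≡N₀+h·S = cong (N₀ ℕ.+_) (begin
      ∑[ r < p₁ ] N (Fin.suc r)                    ≡⟨ sum-cong-≗ N-suc ⟩
      ∑[ r < p₁ ] (if isResidue r then N₊ else N₋) ≡⟨ ∑-if p₁ isResidue N₊ N₋ ⟩
      count p₁ isResidue ℕ.* N₊ ℕ.+ count p₁ (λ r → not (isResidue r)) ℕ.* N₋
        ≡⟨ cong₂ (λ x y → x ℕ.* N₊ ℕ.+ y ℕ.* N₋) count-residues count-nonresidues ⟩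
      h ℕ.* N₊ ℕ.+ h ℕ.* N₋ ≡⟨ sym (ℕP.*-distribˡ-+ h N₊ N₋) ⟩
      h ℕ.* S               ∎)
      where open ≡-Reasoning

    pos[N₀+h·S] : + (N₀ ℕ.+ h ℕ.* S) ≡ + N₀ + + h * (+ N₊ + + N₋)
    pos[N₀+h·S] = trans (ℤP.pos-+ N₀ (h ℕ.* S)) (cong (_+_ (+ N₀)) (trans (ℤP.pos-* h S) (cong (_*_ (+ h)) (ℤP.pos-+ N₊ N₋))))

    I J : ℤ
    I = + 2 * + N₀ - (+ N₊ + + N₋)
    J = + N₊ - + N₋

    private
      value-residue : ∀ I′ J′ → value I′ J′ (Fin.suc r₊) ≡ + 2 * + N₊ - (+ 0 + J′ * + 1)
      value-residue I′ J′ = cong (λ b → + 2 * + N₊ - (+ 0 + J′ * sign b)) (proj₂ (residue 1≤h))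

      value-nonresidue : ∀ I′ J′ → value I′ J′ (Fin.suc r₋) ≡ + 2 * + N₋ - (+ 0 + J′ * - + 1)
      value-nonresidue I′ J′ = cong (λ b → + 2 * + N₋ - (+ 0 + J′ * sign b)) (proj₂ (nonresidue 1≤h))

    value≡N₊+N₋ : ∀ t → value I J t ≡ + N₊ + + N₋
    value≡N₊+N₋ Fin.zero = solve 3 (λ c a b → con (+ 2) :* c :- ((con (+ 2) :* c :- (a :+ b)) :+ (a :- b) :* con (+ 0)) := a :+ b)
      refl (+ N₀) (+ N₊) (+ N₋)
    value≡N₊+N₋ (Fin.suc r) = on-class (isResidue r) (N-suc r)
      where
      on-class : ∀ b → N (Fin.suc r) ≡ (if b then N₊ else N₋) → + 2 * + N (Fin.suc r) - (+ 0 + J * sign b) ≡ + N₊ + + N₋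
      on-class true  N≡N₊ = trans (cong (λ x → + 2 * + x - (+ 0 + J * + 1)) N≡N₊)
        (solve 2 (λ a b → con (+ 2) :* a :- (con (+ 0) :+ (a :- b) :* con (+ 1)) := a :+ b) refl (+ N₊) (+ N₋))
      on-class false N≡N₋ = trans (cong (λ x → + 2 * + x - (+ 0 + J * - + 1)) N≡N₋)
        (solve 2 (λ a b → con (+ 2) :* b :- (con (+ 0) :+ (a :- b) :* (:- con (+ 1))) := a :+ b) refl (+ N₊) (+ N₋))

    2W≈I+J√p : (fromℤ (+ 2) ·ᶜ W′) ≈ᶜ (embed (fromℤ I) +ᶜ (fromℤ J ·ᶜ sqrtp p))
    2W≈I+J√p = fromℤ (+ N₊ + + N₋) , λ t → trans (fromℤ-value I J t) (cong fromℤ (value≡N₊+N₋ t))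

    2W≈I+J√p-unique : ∀ I′ J′ → (fromℤ (+ 2) ·ᶜ W′) ≈ᶜ (embed (fromℤ I′) +ᶜ (fromℤ J′ ·ᶜ sqrtp p)) →
                      I′ ≡ I × J′ ≡ J
    2W≈I+J√p-unique I′ J′ (c′ , 2W-I′-J′√p≡c′) = I′≡I , J′≡J
      where
      open ≡-Reasoning
      same-value : ∀ t t′ → value I′ J′ t ≡ value I′ J′ t′
      same-value t t′ = fromℤ-injective (begin
        fromℤ (value I′ J′ t)  ≡⟨ sym (fromℤ-value I′ J′ t) ⟩
        _                      ≡⟨ 2W-I′-J′√p≡c′ t ⟩
        c′                     ≡⟨ sym (2W-I′-J′√p≡c′ t′) ⟩
        _                      ≡⟨ fromℤ-value I′ J′ t′ ⟩
        fromℤ (value I′ J′ t′) ∎)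
      X₀ X₊ X₋ : ℤ
      X₀ = + 2 * + N₀ - (I′ + J′ * + 0)
      X₊ = + 2 * + N₊ - (+ 0 + J′ * + 1)
      X₋ = + 2 * + N₋ - (+ 0 + J′ * - + 1)
      X₀≡X₊ : X₀ ≡ X₊
      X₀≡X₊ = trans (same-value Fin.zero (Fin.suc r₊)) (value-residue I′ J′)
      X₋≡X₊ : X₋ ≡ X₊
      X₋≡X₊ = trans (sym (value-nonresidue I′ J′)) (trans (same-value (Fin.suc r₋) (Fin.suc r₊)) (value-residue I′ J′))
      J′≡J : J′ ≡ J
      J′≡J = ℤP.*-cancelˡ-≡ (+ 2) J′ J (begin
        + 2 * J′
          ≡⟨ solve 3 (λ j a b → con (+ 2) :* j
                                := (con (+ 2) :* b :- (con (+ 0) :+ j :* (:- con (+ 1))))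
                                   :- (con (+ 2) :* a :- (con (+ 0) :+ j :* con (+ 1))) :+ con (+ 2) :* (a :- b))
               refl J′ (+ N₊) (+ N₋) ⟩
        X₋ - X₊ + + 2 * J
          ≡⟨ cong (λ x → x - X₊ + + 2 * J) X₋≡X₊ ⟩
        X₊ - X₊ + + 2 * J
          ≡⟨ solve 2 (λ x y → x :- x :+ y := y) refl X₊ (+ 2 * J) ⟩
        + 2 * J
          ∎)
      I′≡I : I′ ≡ I
      I′≡I = begin
        I′
          ≡⟨ solve 3 (λ i j c → i := con (+ 2) :* c :- (con (+ 2) :* c :- (i :+ j :* con (+ 0)))) refl I′ J′ (+ N₀) ⟩
        + 2 * + N₀ - X₀
          ≡⟨ cong (_-_ (+ 2 * + N₀)) X₀≡X₊ ⟩
        + 2 * + N₀ - X₊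
          ≡⟨ cong (λ j → + 2 * + N₀ - (+ 2 * + N₊ - (+ 0 + j * + 1))) J′≡J ⟩
        + 2 * + N₀ - (+ 2 * + N₊ - (+ 0 + J * + 1))
          ≡⟨ solve 3 (λ c a b → con (+ 2) :* c :- (con (+ 2) :* a :- (con (+ 0) :+ (a :- b) :* con (+ 1)))
                                := con (+ 2) :* c :- (a :+ b))
               refl (+ N₀) (+ N₊) (+ N₋) ⟩
        I
          ∎

    2∣I-J : + 2 ℤd.∣ I - J
    2∣I-J = subst (+ 2 ℤd.∣_)
      (solve 3 (λ c a b → con (+ 2) :* (c :- a) := (con (+ 2) :* c :- (a :+ b)) :- (a :- b)) refl (+ N₀) (+ N₊) (+ N₋))
      (i∣i*j (+ 2) (+ N₀ - + N₊))

    p∣I : ∀ {n} → 1 ≤ n → ∑[ t < p ] N t ≡ p ℕ.^ n → + p ℤd.∣ I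
    p∣I {suc m} _ ∑N≡pⁿ = subst (+ p ℤd.∣_) (sym I≡p*[2pᵐ-S]) (i∣i*j (+ p) (+ 2 * pᵐ - (+ N₊ + + N₋)))
      where
      open ≡-Reasoning
      pᵐ : ℤ
      pᵐ = + (p ℕ.^ m)
      N₀+h·S≡p·pᵐ : + N₀ + + h * (+ N₊ + + N₋) ≡ (+ 1 + + 2 * + h) * pᵐ
      N₀+h·S≡p·pᵐ = begin
        + N₀ + + h * (+ N₊ + + N₋) ≡⟨ sym pos[N₀+h·S] ⟩
        + (N₀ ℕ.+ h ℕ.* S)         ≡⟨ cong +_ (trans (sym ∑N≡N₀+h·S) ∑N≡pⁿ) ⟩
        + (p ℕ.* p ℕ.^ m)          ≡⟨ ℤP.pos-* p (p ℕ.^ m) ⟩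
        + p * pᵐ                   ≡⟨ cong (_* pᵐ) pos-p ⟩
        (+ 1 + + 2 * + h) * pᵐ     ∎
      I≡p*[2pᵐ-S] : I ≡ + p * (+ 2 * pᵐ - (+ N₊ + + N₋))
      I≡p*[2pᵐ-S] = begin
        I
          ≡⟨ solve 4 (λ c h a b → con (+ 2) :* c :- (a :+ b) := con (+ 2) :* (c :+ h :* (a :+ b)) :- (con (+ 1) :+ con (+ 2) :* h) :* (a :+ b))
               refl (+ N₀) (+ h) (+ N₊) (+ N₋) ⟩
        + 2 * (+ N₀ + + h * (+ N₊ + + N₋)) - (+ 1 + + 2 * + h) * (+ N₊ + + N₋)
          ≡⟨ cong (λ x → + 2 * x - (+ 1 + + 2 * + h) * (+ N₊ + + N₋)) N₀+h·S≡p·pᵐ ⟩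
        + 2 * ((+ 1 + + 2 * + h) * pᵐ) - (+ 1 + + 2 * + h) * (+ N₊ + + N₋)
          ≡⟨ solve 4 (λ h m a b → con (+ 2) :* ((con (+ 1) :+ con (+ 2) :* h) :* m) :- (con (+ 1) :+ con (+ 2) :* h) :* (a :+ b)
                                  := (con (+ 1) :+ con (+ 2) :* h) :* (con (+ 2) :* m :- (a :+ b)))
               refl (+ h) pᵐ (+ N₊) (+ N₋) ⟩
        (+ 1 + + 2 * + h) * (+ 2 * pᵐ - (+ N₊ + + N₋))
          ≡⟨ cong (λ x → x * (+ 2 * pᵐ - (+ N₊ + + N₋))) (sym pos-p) ⟩
        + p * (+ 2 * pᵐ - (+ N₊ + + N₋))
          ∎

    module Bounds {q} (∑N≡q : ∑[ t < p ] N t ≡ q) (1≤N₀ : 1 ≤ N₀) (N₀≢q : N₀ ≢ q) where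

      q≡N₀+h·S : q ≡ N₀ ℕ.+ h ℕ.* S
      q≡N₀+h·S = trans (sym ∑N≡q) ∑N≡N₀+h·S

      N₀≤q : N₀ ≤ q
      N₀≤q = subst (N₀ ≤_) (sym q≡N₀+h·S) (ℕP.m≤m+n N₀ (h ℕ.* S))

      1≤q : 1 ≤ q
      1≤q = ℕP.≤-trans 1≤N₀ N₀≤q

      1≤S : 1 ≤ S
      1≤S = ℕP.n≢0⇒n>0 λ S≡0 → N₀≢q (sym (begin
        q              ≡⟨ q≡N₀+h·S ⟩
        N₀ ℕ.+ h ℕ.* S ≡⟨ cong (λ x → N₀ ℕ.+ h ℕ.* x) S≡0 ⟩
        N₀ ℕ.+ h ℕ.* 0 ≡⟨ cong (N₀ ℕ.+_) (ℕP.*-zeroʳ h) ⟩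
        N₀ ℕ.+ 0       ≡⟨ ℕP.+-identityʳ N₀ ⟩
        N₀             ∎))
        where open ≡-Reasoning

      2[q∸1]<q·p₁ : 2 ℕ.* (q ∸ 1) < q ℕ.* p₁
      2[q∸1]<q·p₁ = ℕP.<-≤-trans (ℕP.*-monoʳ-< 2 (ℕP.∸-monoʳ-< {q} {1} {0} (s≤s z≤n) 1≤q))
        (subst (_≤ q ℕ.* p₁) (ℕP.*-comm q 2) (ℕP.*-monoʳ-≤ q (subst (2 ≤_) (sym p₁≡2h) (ℕP.*-monoʳ-≤ 2 1≤h))))

      2[q-1]<q[p-1] : + (2 ℕ.* (q ∸ 1)) ℤ.< + q * + (p ∸ 1)
      2[q-1]<q[p-1] = subst (+ (2 ℕ.* (q ∸ 1)) ℤ.<_) (ℤP.pos-* q p₁) (ℤ.+<+ 2[q∸1]<q·p₁)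

      -q[p-1]<-2[q-1] : - + q * + (p ∸ 1) ℤ.< - + (2 ℕ.* (q ∸ 1))
      -q[p-1]<-2[q-1] = subst (ℤ._< - + (2 ℕ.* (q ∸ 1))) (ℤP.neg-distribˡ-* (+ q) (+ p₁))
        (ℤP.neg-mono-< 2[q-1]<q[p-1])

      I<2q : I ℤ.< + (2 ℕ.* q)
      I<2q = begin-strict
        I                    ≡⟨ cong₂ _-_ (sym (ℤP.pos-* 2 N₀)) (sym (ℤP.pos-+ N₊ N₋)) ⟩
        + (2 ℕ.* N₀) + - + S <⟨ ℤP.+-monoʳ-< (+ (2 ℕ.* N₀)) (-S<0 1≤S) ⟩
        + (2 ℕ.* N₀) + + 0   ≡⟨ ℤP.+-identityʳ _ ⟩
        + (2 ℕ.* N₀)         ≤⟨ ℤ.+≤+ (ℕP.*-monoʳ-≤ 2 N₀≤q) ⟩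
        + (2 ℕ.* q)          ∎
        where
        open ℤP.≤-Reasoning
        -S<0 : ∀ {x} → 1 ≤ x → - + x ℤ.< + 0
        -S<0 (s≤s _) = ℤ.-<+

      ∣J∣[p-1]≤2[q-1] : + ℤ.∣ J ∣ * + (p ∸ 1) ℤ.≤ + (2 ℕ.* (q ∸ 1))
      ∣J∣[p-1]≤2[q-1] = subst (ℤ._≤ + (2 ℕ.* (q ∸ 1))) (ℤP.pos-* ℤ.∣ J ∣ p₁) (ℤ.+≤+ (begin
        ℤ.∣ J ∣ ℕ.* p₁  ≤⟨ ℕP.*-monoˡ-≤ p₁ (ℤP.∣i-j∣≤∣i∣+∣j∣ (+ N₊) (+ N₋)) ⟩
        S ℕ.* p₁        ≡⟨ cong (S ℕ.*_) p₁≡2h ⟩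
        S ℕ.* (2 ℕ.* h) ≡⟨ trans (ℕP.*-comm S (2 ℕ.* h)) (ℕP.*-assoc 2 h S) ⟩
        2 ℕ.* (h ℕ.* S) ≡⟨ cong (2 ℕ.*_) (sym (trans (cong (_∸ N₀) q≡N₀+h·S) (ℕP.m+n∸m≡n N₀ (h ℕ.* S)))) ⟩
        2 ℕ.* (q ∸ N₀)  ≤⟨ ℕP.*-monoʳ-≤ 2 (ℕP.∸-monoʳ-≤ q 1≤N₀) ⟩
        2 ℕ.* (q ∸ 1)   ∎))
        where
        open ℕP.≤-Reasoning

      -2[q-1]<I[p-1] : - + (2 ℕ.* (q ∸ 1)) ℤ.< I * + (p ∸ 1)
      -2[q-1]<I[p-1] = begin-strict
        - + (2 ℕ.* (q ∸ 1))          ≡⟨ -2[x-1]≡2-2x q 1≤q ⟩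
        + 2 - + 2 * + q              <⟨ ℤP.+-monoˡ-< (- (+ 2 * + q)) 2<2pN₀ ⟩
        + 2 * (P * + N₀) - + 2 * + q ≡⟨ sym I[p-1]≡2pN₀-2q ⟩
        I * + (p ∸ 1)                ∎
        where
        open ℤP.≤-Reasoning
        P : ℤ
        P = + 1 + + 2 * + h
        P≡p : P ≡ + p
        P≡p = sym pos-p
        -2[x-1]≡2-2x : ∀ x → 1 ≤ x → - + (2 ℕ.* (x ∸ 1)) ≡ + 2 - + 2 * + x
        -2[x-1]≡2-2x (suc x) _ = begin-equality
          - + (2 ℕ.* x)           ≡⟨ cong -_ (ℤP.pos-* 2 x) ⟩
          - (+ 2 * + x)           ≡⟨ solve 1 (λ x → :- (con (+ 2) :* x) := con (+ 2) :- con (+ 2) :* (con (+ 1) :+ x)) refl (+ x) ⟩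
          + 2 - + 2 * (+ 1 + + x) ≡⟨ cong (λ y → + 2 - + 2 * y) (sym (ℤP.pos-+ 1 x)) ⟩
          + 2 - + 2 * + (suc x)   ∎
        2<2pN₀ : + 2 ℤ.< + 2 * (P * + N₀)
        2<2pN₀ = subst (+ 2 ℤ.<_) (sym (trans (cong (λ y → + 2 * (y * + N₀)) P≡p)
                                              (trans (cong (_*_ (+ 2)) (sym (ℤP.pos-* p N₀))) (sym (ℤP.pos-* 2 (p ℕ.* N₀))))))
          (ℤ.+<+ (ℕP.*-monoʳ-< 2 (ℕP.<-≤-trans (prime⇒1<p p-prime) (ℕP.m≤m*n p N₀ {{ℕ.>-nonZero 1≤N₀}}))))
        I[p-1]≡2pN₀-2q : I * + (p ∸ 1) ≡ + 2 * (P * + N₀) - + 2 * + q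
        I[p-1]≡2pN₀-2q = begin-equality
          I * + p₁                           ≡⟨ cong (_*_ I) (trans (cong +_ p₁≡2h) (ℤP.pos-* 2 h)) ⟩
          I * (+ 2 * + h)
            ≡⟨ solve 4 (λ c a b h → (con (+ 2) :* c :- (a :+ b)) :* (con (+ 2) :* h)
                                    := con (+ 2) :* ((con (+ 1) :+ con (+ 2) :* h) :* c) :- con (+ 2) :* (c :+ h :* (a :+ b)))
                 refl (+ N₀) (+ N₊) (+ N₋) (+ h) ⟩
          + 2 * (P * + N₀) - + 2 * (+ N₀ + + h * (+ N₊ + + N₋))
            ≡⟨ cong (λ y → + 2 * (P * + N₀) - + 2 * y) (trans (sym pos[N₀+h·S]) (cong +_ (sym q≡N₀+h·S))) ⟩
          + 2 * (P * + N₀) - + 2 * + q ∎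

open import Data.Integer.Base using (+_)

lemma3p6 : (K : FiniteField) (p n : ℕ) → Prime p → p ℕ.% 4 ≡ 1 → 1 ℕ.≤ n
    → FiniteField.size K ≡ p ℕ.^ n
    → FiniteField._≈_ K (FiniteField._·1×_ K p (FiniteField.1# K)) (FiniteField.0# K)
    → (s : ℕ) → 0 ℕ.< s → gcd s (FiniteField.size K ∸ 1) ≡ 1
    → (u : FiniteField.Carrier K)
    → ∃₂ (λ (a b : ℚ) → W K p n s u ≈ᶜ (embed a +ᶜ (b ·ᶜ sqrtp p)))
    → ∃₂ λ (I J : ℤ) →
        ((((+ 2) ℚ./ 1) ·ᶜ W K p n s u) ≈ᶜ (embed (I ℚ./ 1) +ᶜ ((J ℚ./ 1) ·ᶜ sqrtp p)))
      × (∀ (I′ J′ : ℤ)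
           → ((((+ 2) ℚ./ 1) ·ᶜ W K p n s u) ≈ᶜ (embed (I′ ℚ./ 1) +ᶜ ((J′ ℚ./ 1) ·ᶜ sqrtp p)))
           → (I′ ≡ I × J′ ≡ J))
      × ((+ 2) ℤd.∣ (I ℤ.- J))
      × ((+ p) ℤd.∣ I)
      × (Nondegenerate p (FiniteField.size K) s
           → ((ℤ.- (+ FiniteField.size K)) ℤ.* (+ (p ∸ 1)) ℤ.< ℤ.- (+ (2 ℕ.* (FiniteField.size K ∸ 1))))
           × (ℤ.- (+ (2 ℕ.* (FiniteField.size K ∸ 1))) ℤ.< I ℤ.* (+ (p ∸ 1)))
           × (I ℤ.< + (2 ℕ.* FiniteField.size K))
           × ((+ ℤ.∣ J ∣) ℤ.* (+ (p ∸ 1)) ℤ.≤ + (2 ℕ.* (FiniteField.size K ∸ 1)))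
           × ((+ (2 ℕ.* (FiniteField.size K ∸ 1))) ℤ.< (+ FiniteField.size K) ℤ.* (+ (p ∸ 1))))
lemma3p6 K zero     _ p-prime _ _ _ _ _ _ _ _ _ = ⊥-elim (ℕP.n≮0 (prime⇒1<p p-prime))
lemma3p6 K (suc p₁) n p-prime p≡1[4] 1≤n size≡pⁿ char s 0<s gcd≡1 u (a , b , W∈ℚ[√p]) =
  I , J , 2W≈I+J√p , 2W≈I+J√p-unique , 2∣I-J , p∣I 1≤n (≡.trans ∑N≡q size≡pⁿ) , λ nondegenerate →
    let open Bounds ∑N≡q (1≤N₀ 0<s Fin.zero ≡.refl) (N₀≢q 0<s gcd≡1 nondegenerate Fin.zero ≡.refl) in
    -q[p-1]<-2[q-1] , -2[q-1]<I[p-1] , I<2q , ∣J∣[p-1]≤2[q-1] , 2[q-1]<q[p-1]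
  where
  p-1≡2h : ∃ λ h → 1 ≤ h × p₁ ≡ 2 ℕ.* h
  p-1≡2h = prime≡1[4]⇒p-1≡2h p-prime p≡1[4]
  open WeilCounts K p-prime char n size≡pⁿ s u using (∑N≡q; 1≤N₀)
  open TracePolynomial K p-prime char 1≤n size≡pⁿ s u using (N₀≢q)
  open QuadraticWeilSum {h = proj₁ p-1≡2h} p-prime (proj₂ (proj₂ p-1≡2h)) (proj₁ (proj₂ p-1≡2h))
                        (WeilSum.N K (suc p₁) n s u)
  open InQuadraticField {a} {b} W∈ℚ[√p]
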